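{- Fix integers $r,t\ge 2$. Let $M$ be a rank-$r$ matroid on $(r-1)t+1$ elements such that for each $i\in[r]$ every rank-$i$ flat has at most $(i-1)t+1$ elements. For $i\in[r]$ call a rank-$i$ flat with $(i-1)t+1$ elements large, and call a flag large if it is one of the chains counted by $F_{0,r}(M;0,1,t+1,2t+1,\ldots,(r-1)t+1)$. Then $M$ has at most $(r-1)!\,(t+1)$ large flags, and $M$ has exactly $(r-1)!\,(t+1)$ large flags if and only if $M$ is an $(r,r-1,t+1)$-spike. Also, if $r>2$, then $M$ has at most $r-1$ large hyperplanes, and $M$ has exactly $(r-1)!\,(t+1)$ large flags if and only if $M$ has $r-1$ large hyperplanes.
   Context: All matroids are finite. For a matroid $N$ of rank $r$ and integers $s_0,\ldots,s_r$, $F_{0,r}(N;s_0,\ldots,s_r)$ is the number of chains $F_0\subsetneq\cdots\subsetneq F_r$ of flats with $r(F_i)=i$ and $|F_i|=s_i$. For $r\ge3$, an $(r,r-1,t+1)$-spike (with tip $a$) is a simple rank-$r$ matroid whose ground set is the union of $r-1$ lines, each with $t+1$ elements and each containing $a$, such that for every $k\in[r-1]$ the union of any $k$ of these lines has rank $k+1$ (equivalently, the parallel connection at $a$ of $r-1$ lines with $t+1$ elements each). By convention, a $(2,1,t+1)$-spike is a $(t+1)$-point line $U_{2,t+1}$. -}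

module Defs where

open import Data.Nat using (ℕ; zero; suc; _+_; _*_; _∸_; _≤_; _<_; _≟_)
open import Data.Bool using (Bool; true; false)
open import Data.Fin using (Fin; toℕ; inject₁)
  renaming (zero to fzero; suc to fsuc)
open import Data.Fin.Subset using (Subset; _∈_; _∉_; _⊆_; _⊂_; _∪_; _∩_; ⁅_⁆; ∣_∣; ⊤; ⊥)
open import Data.Fin.Subset.Properties using (_∈?_; _⊂?_)
open import Data.Fin.Properties using (all?)
open import Data.Vec using (Vec; []; _∷_; lookup)
open import Data.List using (List; []; _∷_; map; concatMap; filter; length; _++_)
open import Data.Product using (_×_; Σ)
open import Data.Empty using (⊥-elim)
open import Relation.Nullary using (Dec; yes; no; ¬_)
open import Relation.Nullary.Decidable using (_×-dec_; _→-dec_)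
open import Data.Nat.Properties using (_<?_)
open import Relation.Binary.PropositionalEquality using (_≡_; _≢_)

record Matroid (n : ℕ) : Set where
  field
    rk        : Subset n → ℕ
    rk-bound  : ∀ X → rk X ≤ ∣ X ∣
    rk-mono   : ∀ X Y → X ⊆ Y → rk X ≤ rk Y
    rk-submod : ∀ X Y → rk (X ∪ Y) + rk (X ∩ Y) ≤ rk X + rk Y
open Matroid public

rank : ∀ {n} → Matroid n → ℕ
rank M = rk M ⊤

IsFlat : ∀ {n} → Matroid n → Subset n → Set
IsFlat M X = ∀ e → e ∉ X → rk M X < rk M (X ∪ ⁅ e ⁆)

isFlat? : ∀ {n} (M : Matroid n) (X : Subset n) → Dec (IsFlat M X)
isFlat? M X = all? (λ e → (e ∈? X) →-dec-neg (rk M X <? rk M (X ∪ ⁅ e ⁆)))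
  where
  _→-dec-neg_ : ∀ {P Q : Set} → Dec P → Dec Q → Dec (¬ P → Q)
  yes p →-dec-neg _     = yes (λ np → ⊥-elim (np p))
  no ¬p →-dec-neg yes q = yes (λ _ → q)
  no ¬p →-dec-neg no ¬q = no (λ f → ¬q (f ¬p))

allSubsets : (n : ℕ) → List (Subset n)
allSubsets zero    = [] ∷ []
allSubsets (suc n) = map (true ∷_) (allSubsets n) ++ map (false ∷_) (allSubsets n)

allVecs : ∀ {A : Set} → List A → (k : ℕ) → List (Vec A k)
allVecs xs zero    = [] ∷ []
allVecs xs (suc k) = concatMap (λ x → map (x ∷_) (allVecs xs k)) xs

IsFlagChain : ∀ {n} → Matroid n → (r : ℕ) → (Fin (suc r) → ℕ) → Vec (Subset n) (suc r) → Set
IsFlagChain M r s F =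
  (∀ (i : Fin (suc r)) →
     IsFlat M (lookup F i) × rk M (lookup F i) ≡ toℕ i × ∣ lookup F i ∣ ≡ s i)
  × (∀ (i : Fin r) → lookup F (inject₁ i) ⊂ lookup F (fsuc i))

isFlagChain? : ∀ {n} (M : Matroid n) r s F → Dec (IsFlagChain M r s F)
isFlagChain? M r s F =
  all? (λ i → isFlat? M (lookup F i) ×-dec ((rk M (lookup F i) ≟ toℕ i) ×-dec (∣ lookup F i ∣ ≟ s i)))
  ×-dec all? (λ i → lookup F (inject₁ i) ⊂? lookup F (fsuc i))

F0r : ∀ {n} → Matroid n → (r : ℕ) → (Fin (suc r) → ℕ) → ℕ
F0r {n} M r s = length (filter (isFlagChain? M r s) (allVecs (allSubsets n) (suc r)))

largeSizes : (t : ℕ) → {r : ℕ} → Fin (suc r) → ℕ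
largeSizes t i with toℕ i
... | zero  = 0
... | suc j = j * t + 1

largeFlags : ∀ {n} → Matroid n → (r t : ℕ) → ℕ
largeFlags M r t = F0r M r (largeSizes t)

IsLargeFlat : ∀ {n} → Matroid n → (t i : ℕ) → Subset n → Set
IsLargeFlat M t i X = IsFlat M X × rk M X ≡ i × ∣ X ∣ ≡ (i ∸ 1) * t + 1

isLargeFlat? : ∀ {n} (M : Matroid n) t i X → Dec (IsLargeFlat M t i X)
isLargeFlat? M t i X = isFlat? M X ×-dec ((rk M X ≟ i) ×-dec (∣ X ∣ ≟ (i ∸ 1) * t + 1))

largeHyperplanes : ∀ {n} → Matroid n → (r t : ℕ) → ℕ
largeHyperplanes {n} M r t = length (filter (isLargeFlat? M t (r ∸ 1)) (allSubsets n))

bigUnion : ∀ {m n} → (Fin m → Subset n) → Subset m → Subset n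
bigUnion {zero}  L []      = ⊥
bigUnion {suc m} L (b ∷ K) with b
... | true  = L fzero ∪ bigUnion (λ i → L (fsuc i)) K
... | false = bigUnion (λ i → L (fsuc i)) K

IsSimple : ∀ {n} → Matroid n → Set
IsSimple M = (∀ e → rk M ⁅ e ⁆ ≡ 1) × (∀ e f → e ≢ f → rk M (⁅ e ⁆ ∪ ⁅ f ⁆) ≡ 2)

-- M is an (r, r-1, t+1)-spike: simple, rank r, ground set the union of r-1
-- lines (rank-2 flats) with t+1 elements each, all containing the tip a,
-- such that any k ≥ 1 of the lines have union of rank k+1.
-- (For r = 2 this is exactly U_{2,t+1}, matching the convention.)
IsSpike : ∀ {n} → Matroid n → (r t : ℕ) → Set
IsSpike {n} M r t =
  IsSimple M × rank M ≡ r ×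
  Σ (Fin n) λ a → Σ (Fin (r ∸ 1) → Subset n) λ L →
    (∀ i → IsFlat M (L i) × rk M (L i) ≡ 2 × ∣ L i ∣ ≡ t + 1 × a ∈ L i)
    × bigUnion L ⊤ ≡ ⊤
    × (∀ (K : Subset (r ∸ 1)) → 1 ≤ ∣ K ∣ → rk M (bigUnion L K) ≡ ∣ K ∣ + 1)

-- Let G be a large flat of rank m + 1 ≥ 3. Two distinct large hyperplanes H, K of G meet in a set of
-- rank at most m - 1, hence of at most (m - 2)t + 1 elements, so |H ∪ K| ≥ mt + 1 = |G| and H ∪ K = G.
-- Thus every element of G is missed by at most one large hyperplane of G, while each of them misses
-- exactly t elements; counting with t ≥ 2 shows that G has at most m large hyperplanes. By induction on
-- the rank, a large rank-k flat tops at most (k - 1)!(t + 1) large flags (t + 1 for a line, one per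
-- point), with equality iff it has k - 1 large hyperplanes and each of them attains its bound; the map
-- K ↦ H ∩ K embeds the other large hyperplanes of G into those of H, so equality passes downwards.
-- Finally, r - 1 large hyperplanes of M miss pairwise disjoint t-sets of the (r - 1)t + 1 elements,
-- so exactly one element a lies on all of them, and their complements together with a are the lines
-- of a spike; conversely, in a spike the unions of all lines but one are r - 1 large hyperplanes.

module Submission where

open import Defs
open import Data.Nat using (ℕ; zero; suc; _+_; _*_; _∸_; _≤_; _<_; z≤n; s≤s; _≤?_; _≟_; _!; >-nonZero)
open import Data.Nat.Properties
open import Data.Nat.Tactic.RingSolver using (solve-∀)
open import Data.Bool using (Bool; true; false; if_then_else_)
import Data.Bool
open import Data.Fin using (Fin; toℕ; inject₁; fromℕ) renaming (zero to fzero; suc to fsuc)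
open import Data.Fin.Properties using (any?; toℕ-inject₁; toℕ-fromℕ) renaming (_≟_ to _≟ᶠ_; suc-injective to fsuc-injective)
open import Data.Fin.Subset
open import Data.Fin.Subset.Properties
open import Data.Vec using (Vec; []; _∷_; here; there; lookup; tabulate; _∷ʳ_)
open import Data.Vec.Properties using (lookup∘tabulate; lookup⇒[]=; []=⇒lookup; ≡-dec)
import Data.Vec
open import Data.List using (List; []; _∷_; map; concatMap; filter; length; _++_)
import Data.List
open import Data.List.Relation.Unary.Unique.Propositional using (Unique)
open import Data.List.Relation.Unary.Unique.Propositional.Properties using (++⁺; map⁺; filter⁺)
open import Data.List.Relation.Unary.All using ([]; _∷_) renaming (lookup to All-lookup)
open import Data.List.Relation.Unary.AllPairs using ([]; _∷_)
open import Data.List.Membership.Propositional using () renaming (_∈_ to _∈ᴸ_)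
open import Data.List.Membership.Propositional.Properties using (∈-filter⁻; ∈-lookup; ∈-map⁻)
open import Data.Product using (_×_; _,_; Σ; ∃; proj₁; proj₂)
open import Data.Sum using (_⊎_; inj₁; inj₂; [_,_]′)
open import Data.Empty using (⊥-elim)
open import Function.Bundles using (_⇔_; mk⇔)
open import Function.Construct.Composition using (_⇔-∘_)
open import Relation.Nullary using (Dec; yes; no; ¬_; ¬?; does)
open import Relation.Nullary.Decidable using (_×-dec_; decidable-stable)
open import Relation.Unary using (Decidable)
open import Relation.Binary.PropositionalEquality
open import Level using (Level)

private
  variable
    ℓ ℓ′ ℓ″ : Level
    P : Set ℓ
    Q : Set ℓ′
    R : Set ℓ″
    T T′ : Set

-- Indicators and finite sums

-- Defined through `does` so that it computes on decisions built with `map′`, such as `_∈?_`.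
χ : Dec P → ℕ
χ d = if does d then 1 else 0

χ≤1 : (d : Dec P) → χ d ≤ 1
χ≤1 (yes _) = s≤s z≤n
χ≤1 (no _)  = z≤n

χ-yes : (d : Dec P) → P → χ d ≡ 1
χ-yes (yes _) _ = refl
χ-yes (no ¬p) p = ⊥-elim (¬p p)

χ-no : (d : Dec P) → ¬ P → χ d ≡ 0
χ-no (yes p) ¬p = ⊥-elim (¬p p)
χ-no (no _)  _  = refl

χ>0⇒ : (d : Dec P) → 0 < χ d → P
χ>0⇒ (yes p) _ = p

χ-mono : (d : Dec P) (e : Dec Q) → (P → Q) → χ d ≤ χ e
χ-mono (yes p) e f = ≤-reflexive (sym (χ-yes e (f p)))
χ-mono (no _)  e f = z≤n

χ-cong : (d : Dec P) (e : Dec Q) → (P → Q) → (Q → P) → χ d ≡ χ e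
χ-cong d e f g = ≤-antisym (χ-mono d e f) (χ-mono e d g)

χ*χ>0⇒ : (d : Dec P) (e : Dec Q) → 0 < χ d * χ e → P × Q
χ*χ>0⇒ (yes p) (yes q) _ = p , q

χ*χ≤1 : (d : Dec P) (e : Dec Q) → χ d * χ e ≤ 1
χ*χ≤1 d e = *-mono-≤ (χ≤1 d) (χ≤1 e)

χ*χ≤χ : (d : Dec P) (e : Dec Q) (h : Dec R) → (P → Q → R) → χ d * χ e ≤ χ h
χ*χ≤χ (yes p) (yes q) h f = ≤-reflexive (sym (χ-yes h (f p q)))
χ*χ≤χ (yes p) (no _)  h f = z≤n
χ*χ≤χ (no _)  e       h f = z≤n

χ*χ≡χ : (d : Dec P) (e : Dec Q) (h : Dec R) →
  (P → Q → R) → (R → P) → (R → Q) → χ d * χ e ≡ χ h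
χ*χ≡χ (yes p) (yes q) h f g₁ g₂ = sym (χ-yes h (f p q))
χ*χ≡χ (yes p) (no ¬q) h f g₁ g₂ = sym (χ-no h (λ r → ¬q (g₂ r)))
χ*χ≡χ (no ¬p) e       h f g₁ g₂ = sym (χ-no h (λ r → ¬p (g₁ r)))

χ*-cong : (d : Dec P) {a b : ℕ} → (P → a ≡ b) → χ d * a ≡ χ d * b
χ*-cong (yes p) f = cong (1 *_) (f p)
χ*-cong (no _)  f = refl

χ*-mono : (d : Dec P) {a b : ℕ} → (P → a ≤ b) → χ d * a ≤ χ d * b
χ*-mono (yes p) f = *-monoʳ-≤ 1 (f p)
χ*-mono (no _)  f = z≤n

≯0⇒≡0 : ∀ {x} → ¬ (0 < x) → x ≡ 0
≯0⇒≡0 h = n≤0⇒n≡0 (≮⇒≥ h)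

Σᴸ : List T → (T → ℕ) → ℕ
Σᴸ []       f = 0
Σᴸ (x ∷ xs) f = f x + Σᴸ xs f

Σᴸ-++ : ∀ (xs ys : List T) f → Σᴸ (xs ++ ys) f ≡ Σᴸ xs f + Σᴸ ys f
Σᴸ-++ []       ys f = refl
Σᴸ-++ (x ∷ xs) ys f = trans (cong (f x +_) (Σᴸ-++ xs ys f)) (sym (+-assoc (f x) _ _))

Σᴸ-map : ∀ (g : T → T′) (xs : List T) f → Σᴸ (map g xs) f ≡ Σᴸ xs (λ x → f (g x))
Σᴸ-map g []       f = refl
Σᴸ-map g (x ∷ xs) f = cong (f (g x) +_) (Σᴸ-map g xs f)

Σᴸ-concatMap : ∀ (g : T → List T′) (xs : List T) f →
  Σᴸ (concatMap g xs) f ≡ Σᴸ xs (λ x → Σᴸ (g x) f)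
Σᴸ-concatMap g []       f = refl
Σᴸ-concatMap g (x ∷ xs) f =
  trans (Σᴸ-++ (g x) (concatMap g xs) f) (cong (Σᴸ (g x) f +_) (Σᴸ-concatMap g xs f))

Σᴸ-cong : (xs : List T) {f g : T → ℕ} → (∀ x → f x ≡ g x) → Σᴸ xs f ≡ Σᴸ xs g
Σᴸ-cong []       e = refl
Σᴸ-cong (x ∷ xs) e = cong₂ _+_ (e x) (Σᴸ-cong xs e)

length-filter≡Σᴸχ : ∀ {Pr : T → Set} (P? : Decidable Pr) (xs : List T) →
  length (filter P? xs) ≡ Σᴸ xs (λ x → χ (P? x))
length-filter≡Σᴸχ P? []       = refl
length-filter≡Σᴸχ P? (x ∷ xs) with P? x
... | yes _ = cong suc (length-filter≡Σᴸχ P? xs)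
... | no _  = length-filter≡Σᴸχ P? xs

Σˢ : ∀ {n} → (Subset n → ℕ) → ℕ
Σˢ {zero}  f = f []
Σˢ {suc n} f = Σˢ (λ p → f (true ∷ p)) + Σˢ (λ p → f (false ∷ p))

Σᶠ : ∀ {n} → (Fin n → ℕ) → ℕ
Σᶠ {zero}  f = 0
Σᶠ {suc n} f = f fzero + Σᶠ (λ x → f (fsuc x))

+-interchange : ∀ a b c d → (a + b) + (c + d) ≡ (a + c) + (b + d)
+-interchange = solve-∀

Σˢ-cong : ∀ {n} {f g : Subset n → ℕ} → (∀ x → f x ≡ g x) → Σˢ f ≡ Σˢ g
Σˢ-cong {zero}  e = e []
Σˢ-cong {suc n} e = cong₂ _+_ (Σˢ-cong (λ p → e (true ∷ p))) (Σˢ-cong (λ p → e (false ∷ p)))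

Σᶠ-cong : ∀ {n} {f g : Fin n → ℕ} → (∀ x → f x ≡ g x) → Σᶠ f ≡ Σᶠ g
Σᶠ-cong {zero}  e = refl
Σᶠ-cong {suc n} e = cong₂ _+_ (e fzero) (Σᶠ-cong (λ p → e (fsuc p)))

Σˢ-mono : ∀ {n} {f g : Subset n → ℕ} → (∀ x → f x ≤ g x) → Σˢ f ≤ Σˢ g
Σˢ-mono {zero}  e = e []
Σˢ-mono {suc n} e = +-mono-≤ (Σˢ-mono (λ p → e (true ∷ p))) (Σˢ-mono (λ p → e (false ∷ p)))

Σᶠ-mono : ∀ {n} {f g : Fin n → ℕ} → (∀ x → f x ≤ g x) → Σᶠ f ≤ Σᶠ g
Σᶠ-mono {zero}  e = z≤n
Σᶠ-mono {suc n} e = +-mono-≤ (e fzero) (Σᶠ-mono (λ p → e (fsuc p)))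

Σˢ-distrib-+ : ∀ {n} (f g : Subset n → ℕ) → Σˢ (λ x → f x + g x) ≡ Σˢ f + Σˢ g
Σˢ-distrib-+ {zero}  f g = refl
Σˢ-distrib-+ {suc n} f g = trans (cong₂ _+_ (Σˢ-distrib-+ {n} _ _) (Σˢ-distrib-+ {n} _ _))
  (+-interchange (Σˢ (λ p → f (true ∷ p))) (Σˢ (λ p → g (true ∷ p))) _ _)

Σᶠ-distrib-+ : ∀ {n} (f g : Fin n → ℕ) → Σᶠ (λ x → f x + g x) ≡ Σᶠ f + Σᶠ g
Σᶠ-distrib-+ {zero}  f g = refl
Σᶠ-distrib-+ {suc n} f g = trans (cong (f fzero + g fzero +_) (Σᶠ-distrib-+ {n} _ _))
  (+-interchange (f fzero) (g fzero) _ _)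

Σˢ-*ˡ : ∀ {n} c (f : Subset n → ℕ) → Σˢ (λ x → c * f x) ≡ c * Σˢ f
Σˢ-*ˡ {zero}  c f = refl
Σˢ-*ˡ {suc n} c f = trans (cong₂ _+_ (Σˢ-*ˡ {n} c _) (Σˢ-*ˡ {n} c _)) (sym (*-distribˡ-+ c _ _))

Σˢ-zero : ∀ {n} (f : Subset n → ℕ) → (∀ x → f x ≡ 0) → Σˢ f ≡ 0
Σˢ-zero {zero}  f e = e []
Σˢ-zero {suc n} f e = cong₂ _+_ (Σˢ-zero _ (λ p → e (true ∷ p))) (Σˢ-zero _ (λ p → e (false ∷ p)))

Σᶠ-zero : ∀ {n} (f : Fin n → ℕ) → (∀ x → f x ≡ 0) → Σᶠ f ≡ 0
Σᶠ-zero {zero}  f e = refl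
Σᶠ-zero {suc n} f e = cong₂ _+_ (e fzero) (Σᶠ-zero _ (λ p → e (fsuc p)))

Σᶠ-const : ∀ {n} c → Σᶠ {n} (λ _ → c) ≡ n * c
Σᶠ-const {zero}  c = refl
Σᶠ-const {suc n} c = cong (c +_) (Σᶠ-const {n} c)

module Interchange {A : Set} (Φ : (A → ℕ) → ℕ)
  (Φ-distrib-+ : ∀ f g → Φ (λ x → f x + g x) ≡ Φ f + Φ g)
  (Φ-zero : ∀ f → (∀ x → f x ≡ 0) → Φ f ≡ 0) where

  Σˢ-Φ : ∀ {n} (h : Subset n → A → ℕ) → Σˢ (λ p → Φ (h p)) ≡ Φ (λ a → Σˢ (λ p → h p a))
  Σˢ-Φ {zero}  h = refl
  Σˢ-Φ {suc n} h = trans (cong₂ _+_ (Σˢ-Φ {n} _) (Σˢ-Φ {n} _)) (sym (Φ-distrib-+ _ _))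

  Σᶠ-Φ : ∀ {n} (h : Fin n → A → ℕ) → Σᶠ (λ p → Φ (h p)) ≡ Φ (λ a → Σᶠ (λ p → h p a))
  Σᶠ-Φ {zero}  h = sym (Φ-zero _ (λ _ → refl))
  Σᶠ-Φ {suc n} h = trans (cong (Φ (h fzero) +_) (Σᶠ-Φ {n} _)) (sym (Φ-distrib-+ _ _))

Σˢ-comm : ∀ {n m} (h : Subset n → Subset m → ℕ) → Σˢ (λ p → Σˢ (h p)) ≡ Σˢ (λ q → Σˢ (λ p → h p q))
Σˢ-comm = Interchange.Σˢ-Φ Σˢ Σˢ-distrib-+ Σˢ-zero

Σᶠ-Σˢ-comm : ∀ {n m} (h : Fin n → Subset m → ℕ) → Σᶠ (λ p → Σˢ (h p)) ≡ Σˢ (λ q → Σᶠ (λ p → h p q))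
Σᶠ-Σˢ-comm = Interchange.Σᶠ-Φ Σˢ Σˢ-distrib-+ Σˢ-zero

Σˢ-Σᶠ-comm : ∀ {n m} (h : Subset n → Fin m → ℕ) → Σˢ (λ p → Σᶠ (h p)) ≡ Σᶠ (λ q → Σˢ (λ p → h p q))
Σˢ-Σᶠ-comm = Interchange.Σˢ-Φ Σᶠ Σᶠ-distrib-+ Σᶠ-zero

Σᶠ-comm : ∀ {n m} (h : Fin n → Fin m → ℕ) → Σᶠ (λ p → Σᶠ (h p)) ≡ Σᶠ (λ q → Σᶠ (λ p → h p q))
Σᶠ-comm = Interchange.Σᶠ-Φ Σᶠ Σᶠ-distrib-+ Σᶠ-zero

Σˢ-single : ∀ {n} (f : Subset n → ℕ) (q : Subset n) → (∀ p → p ≢ q → f p ≡ 0) → Σˢ f ≡ f q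
Σˢ-single {zero}  f [] e = refl
Σˢ-single {suc n} f (true ∷ q) e =
  trans (cong₂ _+_ (Σˢ-single _ q (λ p ne → e (true ∷ p) (λ eq → ne (cong Data.Vec.tail eq))))
                   (Σˢ-zero _ (λ p → e (false ∷ p) (λ ()))))
        (+-identityʳ _)
Σˢ-single {suc n} f (false ∷ q) e =
  cong₂ _+_ (Σˢ-zero _ (λ p → e (true ∷ p) (λ ())))
            (Σˢ-single _ q (λ p ne → e (false ∷ p) (λ eq → ne (cong Data.Vec.tail eq))))

Σᶠ-single : ∀ {n} (f : Fin n → ℕ) (q : Fin n) → (∀ p → p ≢ q → f p ≡ 0) → Σᶠ f ≡ f q
Σᶠ-single {suc n} f fzero e =
  trans (cong (f fzero +_) (Σᶠ-zero _ (λ p → e (fsuc p) (λ ())))) (+-identityʳ _)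
Σᶠ-single {suc n} f (fsuc q) e =
  cong₂ _+_ (e fzero (λ ())) (Σᶠ-single _ q (λ p ne → e (fsuc p) (λ eq → ne (fsuc-injective eq))))

Σˢ>0⇒ : ∀ {n} (f : Subset n → ℕ) → 0 < Σˢ f → ∃ λ p → 0 < f p
Σˢ>0⇒ {zero}  f h = [] , h
Σˢ>0⇒ {suc n} f h with Σˢ (λ p → f (true ∷ p)) in eq
... | suc _ = let (p , q) = Σˢ>0⇒ (λ p → f (true ∷ p)) (subst (0 <_) (sym eq) (s≤s z≤n)) in true ∷ p , q
... | zero  = let (p , q) = Σˢ>0⇒ (λ p → f (false ∷ p)) h in false ∷ p , q

Σᶠ>0⇒ : ∀ {n} (f : Fin n → ℕ) → 0 < Σᶠ f → ∃ λ p → 0 < f p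
Σᶠ>0⇒ {suc n} f h with f fzero in eq
... | suc _ = fzero , subst (0 <_) (sym eq) (s≤s z≤n)
... | zero  = let (p , q) = Σᶠ>0⇒ (λ p → f (fsuc p)) h in fsuc p , q

module SumAtMostOne {X : Set} (Σ′ : (X → ℕ) → ℕ)
  (Σ′-single : ∀ f q → (∀ p → p ≢ q → f p ≡ 0) → Σ′ f ≡ f q)
  (Σ′>0⇒ : ∀ f → 0 < Σ′ f → ∃ λ p → 0 < f p) where

  Σ′≤1 : (f : X → ℕ) → (∀ p → f p ≤ 1) → (∀ p q → 0 < f p → 0 < f q → p ≡ q) → Σ′ f ≤ 1
  Σ′≤1 f f≤1 unique with Σ′ f in eq
  ... | zero  = z≤n
  ... | suc _ =
    let (p , fp>0) = Σ′>0⇒ f (subst (0 <_) (sym eq) (s≤s z≤n))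
        off-p : ∀ q → q ≢ p → f q ≡ 0
        off-p q q≢p = ≯0⇒≡0 (λ fq>0 → q≢p (unique q p fq>0 fp>0))
    in subst (_≤ 1) (trans (sym (Σ′-single f p off-p)) eq) (f≤1 p)

Σˢ≤1 : ∀ {n} (f : Subset n → ℕ) → (∀ p → f p ≤ 1) → (∀ p q → 0 < f p → 0 < f q → p ≡ q) → Σˢ f ≤ 1
Σˢ≤1 = SumAtMostOne.Σ′≤1 Σˢ Σˢ-single Σˢ>0⇒

Σᶠ≤1 : ∀ {n} (f : Fin n → ℕ) → (∀ p → f p ≤ 1) → (∀ p q → 0 < f p → 0 < f q → p ≡ q) → Σᶠ f ≤ 1
Σᶠ≤1 = SumAtMostOne.Σ′≤1 Σᶠ Σᶠ-single Σᶠ>0⇒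

Σᶠ-term : ∀ {n} (f : Fin n → ℕ) q → f q ≤ Σᶠ f
Σᶠ-term {suc n} f fzero    = m≤m+n _ _
Σᶠ-term {suc n} f (fsuc q) = ≤-trans (Σᶠ-term (λ x → f (fsuc x)) q) (m≤n+m _ _)

Σᶠ-two-terms : ∀ {n} (f : Fin n → ℕ) p q → p ≢ q → f p + f q ≤ Σᶠ f
Σᶠ-two-terms {suc n} f fzero    fzero    ne = ⊥-elim (ne refl)
Σᶠ-two-terms {suc n} f fzero    (fsuc q) ne = +-monoʳ-≤ (f fzero) (Σᶠ-term (λ x → f (fsuc x)) q)
Σᶠ-two-terms {suc n} f (fsuc p) fzero    ne =
  subst (_≤ Σᶠ f) (+-comm (f fzero) (f (fsuc p))) (+-monoʳ-≤ (f fzero) (Σᶠ-term (λ x → f (fsuc x)) p))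
Σᶠ-two-terms {suc n} f (fsuc p) (fsuc q) ne =
  ≤-trans (Σᶠ-two-terms (λ x → f (fsuc x)) p q (λ e → ne (cong fsuc e))) (m≤n+m _ _)

-- Subsets

module _ {n : ℕ} where

  ∈∪ˡ : ∀ {p q : Subset n} {x} → x ∈ p → x ∈ p ∪ q
  ∈∪ˡ h = x∈p∪q⁺ (inj₁ h)

  ∈∪ʳ : ∀ {p q : Subset n} {x} → x ∈ q → x ∈ p ∪ q
  ∈∪ʳ h = x∈p∪q⁺ (inj₂ h)

  ∪-least : ∀ {p q s : Subset n} → p ⊆ s → q ⊆ s → p ∪ q ⊆ s
  ∪-least {p} {q} p⊆s q⊆s h = [ p⊆s , q⊆s ]′ (x∈p∪q⁻ p q h)

  _∈?_∖_ : (x : Fin n) (q p : Subset n) → Dec (x ∈ q × x ∉ p)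
  x ∈? q ∖ p = (x ∈? q) ×-dec (¬? (x ∈? p))

  ⊈⇒∃ : ∀ (q p : Subset n) → ¬ (q ⊆ p) → ∃ λ x → x ∈ q × x ∉ p
  ⊈⇒∃ q p q⊈p with any? (λ x → x ∈? q ∖ p)
  ... | yes w = w
  ... | no ¬w = ⊥-elim (q⊈p λ {x} x∈q → decidable-stable (x ∈? p) (λ x∉p → ¬w (x , x∈q , x∉p)))

∣p∣≡Σχ∈ : ∀ {n} (p : Subset n) → ∣ p ∣ ≡ Σᶠ (λ x → χ (x ∈? p))
∣p∣≡Σχ∈ []          = refl
∣p∣≡Σχ∈ (true ∷ p)  = cong suc (∣p∣≡Σχ∈ p)
∣p∣≡Σχ∈ (false ∷ p) = ∣p∣≡Σχ∈ p

module _ {n : ℕ} where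

  χ∈∪+χ∈∩ : ∀ (p q : Subset n) x → χ (x ∈? p ∪ q) + χ (x ∈? p ∩ q) ≡ χ (x ∈? p) + χ (x ∈? q)
  χ∈∪+χ∈∩ p q x with x ∈? p | x ∈? q
  ... | yes a | yes b = cong₂ _+_ (χ-yes (x ∈? p ∪ q) (∈∪ˡ a)) (χ-yes (x ∈? p ∩ q) (x∈p∩q⁺ (a , b)))
  ... | yes a | no b  = cong₂ _+_ (χ-yes (x ∈? p ∪ q) (∈∪ˡ a)) (χ-no (x ∈? p ∩ q) (λ h → b (proj₂ (x∈p∩q⁻ p q h))))
  ... | no a  | yes b = cong₂ _+_ (χ-yes (x ∈? p ∪ q) (∈∪ʳ b)) (χ-no (x ∈? p ∩ q) (λ h → a (proj₁ (x∈p∩q⁻ p q h))))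
  ... | no a  | no b  = cong₂ _+_ (χ-no (x ∈? p ∪ q) (λ h → [ a , b ]′ (x∈p∪q⁻ p q h))) (χ-no (x ∈? p ∩ q) (λ h → a (proj₁ (x∈p∩q⁻ p q h))))

  ∣p∪q∣+∣p∩q∣≡∣p∣+∣q∣ : ∀ (p q : Subset n) → ∣ p ∪ q ∣ + ∣ p ∩ q ∣ ≡ ∣ p ∣ + ∣ q ∣
  ∣p∪q∣+∣p∩q∣≡∣p∣+∣q∣ p q = begin
      ∣ p ∪ q ∣ + ∣ p ∩ q ∣
    ≡⟨ cong₂ _+_ (∣p∣≡Σχ∈ (p ∪ q)) (∣p∣≡Σχ∈ (p ∩ q)) ⟩
      Σᶠ (λ x → χ (x ∈? p ∪ q)) + Σᶠ (λ x → χ (x ∈? p ∩ q))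
    ≡⟨ Σᶠ-distrib-+ (λ x → χ (x ∈? p ∪ q)) (λ x → χ (x ∈? p ∩ q)) ⟨
      Σᶠ (λ x → χ (x ∈? p ∪ q) + χ (x ∈? p ∩ q))
    ≡⟨ Σᶠ-cong (χ∈∪+χ∈∩ p q) ⟩
      Σᶠ (λ x → χ (x ∈? p) + χ (x ∈? q))
    ≡⟨ Σᶠ-distrib-+ (λ x → χ (x ∈? p)) (λ x → χ (x ∈? q)) ⟩
      Σᶠ (λ x → χ (x ∈? p)) + Σᶠ (λ x → χ (x ∈? q))
    ≡⟨ cong₂ _+_ (∣p∣≡Σχ∈ p) (∣p∣≡Σχ∈ q) ⟨
      ∣ p ∣ + ∣ q ∣ ∎
    where open ≡-Reasoning

  χ∈≡χ∈+χ∈∖ : ∀ {p q : Subset n} → p ⊆ q → ∀ x → χ (x ∈? q) ≡ χ (x ∈? p) + χ (x ∈? q ∖ p)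
  χ∈≡χ∈+χ∈∖ {p} {q} p⊆q x with x ∈? p | x ∈? q
  ... | yes a | yes b = refl
  ... | yes a | no b  = ⊥-elim (b (p⊆q a))
  ... | no a  | yes b = refl
  ... | no a  | no b  = refl

  ∣q∣≡∣p∣+Σχ∈∖ : ∀ {p q : Subset n} → p ⊆ q → ∣ q ∣ ≡ ∣ p ∣ + Σᶠ (λ x → χ (x ∈? q ∖ p))
  ∣q∣≡∣p∣+Σχ∈∖ {p} {q} p⊆q = begin
      ∣ q ∣                                                    ≡⟨ ∣p∣≡Σχ∈ q ⟩
      Σᶠ (λ x → χ (x ∈? q))                                    ≡⟨ Σᶠ-cong (χ∈≡χ∈+χ∈∖ p⊆q) ⟩
      Σᶠ (λ x → χ (x ∈? p) + χ (x ∈? q ∖ p))                   ≡⟨ Σᶠ-distrib-+ (λ x → χ (x ∈? p)) (λ x → χ (x ∈? q ∖ p)) ⟩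
      Σᶠ (λ x → χ (x ∈? p)) + Σᶠ (λ x → χ (x ∈? q ∖ p))        ≡⟨ cong (_+ Σᶠ (λ x → χ (x ∈? q ∖ p))) (∣p∣≡Σχ∈ p) ⟨
      ∣ p ∣ + Σᶠ (λ x → χ (x ∈? q ∖ p))                        ∎
    where open ≡-Reasoning

  ∈⇒∣p∣≥1 : ∀ (p : Subset n) {x} → x ∈ p → 1 ≤ ∣ p ∣
  ∈⇒∣p∣≥1 p {x} x∈p = begin
    1                       ≡⟨ χ-yes (x ∈? p) x∈p ⟨
    χ (x ∈? p)              ≤⟨ Σᶠ-term _ x ⟩
    Σᶠ (λ y → χ (y ∈? p))   ≡⟨ ∣p∣≡Σχ∈ p ⟨
    ∣ p ∣                   ∎
    where open ≤-Reasoning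

  ∣p∣≡0⇒∉ : ∀ (p : Subset n) → ∣ p ∣ ≡ 0 → ∀ x → x ∉ p
  ∣p∣≡0⇒∉ p ∣p∣≡0 x x∈p = 1+n≰n (≤-trans (∈⇒∣p∣≥1 p x∈p) (≤-reflexive ∣p∣≡0))

  p⊆q∧∣q∣≤∣p∣⇒p≡q : ∀ {p q : Subset n} → p ⊆ q → ∣ q ∣ ≤ ∣ p ∣ → p ≡ q
  p⊆q∧∣q∣≤∣p∣⇒p≡q {p} {q} p⊆q ∣q∣≤∣p∣ = ⊆-antisym p⊆q q⊆p
    where
    no-difference : Σᶠ (λ x → χ (x ∈? q ∖ p)) ≡ 0
    no-difference = n≤0⇒n≡0 (+-cancelˡ-≤ ∣ p ∣ _ _
      (subst₂ _≤_ (∣q∣≡∣p∣+Σχ∈∖ p⊆q) (sym (+-identityʳ _)) ∣q∣≤∣p∣))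
    q⊆p : q ⊆ p
    q⊆p {x} x∈q with x ∈? p
    ... | yes x∈p = x∈p
    ... | no x∉p  = ⊥-elim (1+n≰n (≤-trans (≤-reflexive (sym (χ-yes (x ∈? q ∖ p) (x∈q , x∉p))))
                      (≤-trans (Σᶠ-term (λ x → χ (x ∈? q ∖ p)) x) (≤-reflexive no-difference))))

  ∣p∪⁅x⁆∣≡1+∣p∣ : ∀ (p : Subset n) x → x ∉ p → ∣ p ∪ ⁅ x ⁆ ∣ ≡ suc ∣ p ∣
  ∣p∪⁅x⁆∣≡1+∣p∣ p x x∉p = begin
      ∣ p ∪ ⁅ x ⁆ ∣                    ≡⟨ +-identityʳ _ ⟨
      ∣ p ∪ ⁅ x ⁆ ∣ + 0                ≡⟨ cong (∣ p ∪ ⁅ x ⁆ ∣ +_) ∣p∩⁅x⁆∣≡0 ⟨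
      ∣ p ∪ ⁅ x ⁆ ∣ + ∣ p ∩ ⁅ x ⁆ ∣    ≡⟨ ∣p∪q∣+∣p∩q∣≡∣p∣+∣q∣ p ⁅ x ⁆ ⟩
      ∣ p ∣ + ∣ ⁅ x ⁆ ∣                ≡⟨ cong (∣ p ∣ +_) (∣⁅x⁆∣≡1 x) ⟩
      ∣ p ∣ + 1                        ≡⟨ +-comm ∣ p ∣ 1 ⟩
      suc ∣ p ∣                        ∎
    where
    open ≡-Reasoning
    ∣p∩⁅x⁆∣≡0 : ∣ p ∩ ⁅ x ⁆ ∣ ≡ 0
    ∣p∩⁅x⁆∣≡0 = trans (cong ∣_∣ (Empty-unique λ { (y , y∈) →
      let (y∈p , y∈⁅x⁆) = x∈p∩q⁻ p ⁅ x ⁆ y∈ in x∉p (subst (_∈ p) (x∈⁅y⁆⇒x≡y x y∈⁅x⁆) y∈p) }))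
      (∣⊥∣≡0 n)

  ∣p∣>0⇒Nonempty : ∀ (p : Subset n) {k} → ∣ p ∣ ≡ suc k → Nonempty p
  ∣p∣>0⇒Nonempty p ∣p∣≡1+k with nonempty? p
  ... | yes ne = ne
  ... | no ¬ne = ⊥-elim (0≢1+n (trans (sym (trans (cong ∣_∣ (Empty-unique ¬ne)) (∣⊥∣≡0 n))) ∣p∣≡1+k))

  ⊆∧∣∣<⇒⊂ : ∀ {p q : Subset n} → p ⊆ q → ∣ p ∣ < ∣ q ∣ → p ⊂ q
  ⊆∧∣∣<⇒⊂ {p} {q} p⊆q ∣p∣<∣q∣ = p⊆q , ⊈⇒∃ q p (λ q⊆p → <⇒≱ ∣p∣<∣q∣ (p⊆q⇒∣p∣≤∣q∣ q⊆p))

_≟ˢ_ : ∀ {n} (p q : Subset n) → Dec (p ≡ q)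
_≟ˢ_ = ≡-dec Data.Bool._≟_

Σˢχ≡ : ∀ {n} (q : Subset n) → Σˢ (λ p → χ (p ≟ˢ q)) ≡ 1
Σˢχ≡ q = trans (Σˢ-single _ q (λ p p≢q → χ-no (p ≟ˢ q) p≢q)) (χ-yes (q ≟ˢ q) refl)

module _ {n : ℕ} where

  ∈bigUnion⁺ : ∀ {m} (L : Fin m → Subset n) K j {x} → j ∈ K → x ∈ L j → x ∈ bigUnion L K
  ∈bigUnion⁺ {suc m} L (true ∷ K)  fzero    here        x∈L = ∈∪ˡ x∈L
  ∈bigUnion⁺ {suc m} L (true ∷ K)  (fsuc j) (there j∈K) x∈L = ∈∪ʳ (∈bigUnion⁺ (λ i → L (fsuc i)) K j j∈K x∈L)
  ∈bigUnion⁺ {suc m} L (false ∷ K) (fsuc j) (there j∈K) x∈L = ∈bigUnion⁺ (λ i → L (fsuc i)) K j j∈K x∈L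

  ∈bigUnion⁻ : ∀ {m} (L : Fin m → Subset n) K {x} → x ∈ bigUnion L K → ∃ λ j → j ∈ K × x ∈ L j
  ∈bigUnion⁻ {zero}  L []         h = ⊥-elim (∉⊥ h)
  ∈bigUnion⁻ {suc m} L (true ∷ K) {x} h with x∈p∪q⁻ (L fzero) (bigUnion (λ i → L (fsuc i)) K) h
  ... | inj₁ x∈L = fzero , here , x∈L
  ... | inj₂ x∈U = let (j , j∈K , x∈L) = ∈bigUnion⁻ (λ i → L (fsuc i)) K x∈U in fsuc j , there j∈K , x∈L
  ∈bigUnion⁻ {suc m} L (false ∷ K) h =
    let (j , j∈K , x∈L) = ∈bigUnion⁻ (λ i → L (fsuc i)) K h in fsuc j , there j∈K , x∈L

  bigInter : ∀ {m} → (Fin m → Subset n) → Subset m → Subset n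
  bigInter {zero}  f []          = ⊤
  bigInter {suc m} f (true ∷ S)  = f fzero ∩ bigInter (λ i → f (fsuc i)) S
  bigInter {suc m} f (false ∷ S) = bigInter (λ i → f (fsuc i)) S

  ∈bigInter⁺ : ∀ {m} (f : Fin m → Subset n) S {x} → (∀ i → i ∈ S → x ∈ f i) → x ∈ bigInter f S
  ∈bigInter⁺ {zero}  f []          h = ∈⊤
  ∈bigInter⁺ {suc m} f (true ∷ S)  h = x∈p∩q⁺ (h fzero here , ∈bigInter⁺ (λ i → f (fsuc i)) S (λ i i∈S → h (fsuc i) (there i∈S)))
  ∈bigInter⁺ {suc m} f (false ∷ S) h = ∈bigInter⁺ (λ i → f (fsuc i)) S (λ i i∈S → h (fsuc i) (there i∈S))

≢⇒∈∁⁅⁆ : ∀ {m} {i j : Fin m} → i ≢ j → i ∈ ∁ ⁅ j ⁆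
≢⇒∈∁⁅⁆ i≢j = x∉p⇒x∈∁p (x≢y⇒x∉⁅y⁆ i≢j)

∈∁⁅⁆⇒≢ : ∀ {m} {i j : Fin m} → i ∈ ∁ ⁅ j ⁆ → i ≢ j
∈∁⁅⁆⇒≢ h = x∉⁅y⁆⇒x≢y (x∈∁p⇒x∉p h)

-- Rank, closure and flats

module RankFacts {n : ℕ} (M : Matroid n) where

  ρ : Subset n → ℕ
  ρ = rk M

  ρ-mono : ∀ {X Y} → X ⊆ Y → ρ X ≤ ρ Y
  ρ-mono {X} {Y} = rk-mono M X Y

  ρ⊥≡0 : ρ ⊥ ≡ 0
  ρ⊥≡0 = n≤0⇒n≡0 (≤-trans (rk-bound M ⊥) (≤-reflexive (∣⊥∣≡0 n)))

  ρ-∪≤ : ∀ X Y → ρ (X ∪ Y) ≤ ρ X + ρ Y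
  ρ-∪≤ X Y = ≤-trans (m≤m+n _ _) (rk-submod M X Y)

  ρ⁅x⁆≤1 : ∀ x → ρ ⁅ x ⁆ ≤ 1
  ρ⁅x⁆≤1 x = ≤-trans (rk-bound M ⁅ x ⁆) (≤-reflexive (∣⁅x⁆∣≡1 x))

  ρ-∪⁅x⁆-absorbed : ∀ X Z x → X ⊆ Z → ρ Z ≤ ρ X → ρ (X ∪ ⁅ x ⁆) ≤ ρ X → ρ (Z ∪ ⁅ x ⁆) ≤ ρ X
  ρ-∪⁅x⁆-absorbed X Z x X⊆Z ρZ≤ρX ρXx≤ρX = +-cancelʳ-≤ (ρ X) _ _ (begin
      ρ (Z ∪ ⁅ x ⁆) + ρ X
        ≤⟨ +-mono-≤ (ρ-mono (∪-least ∈∪ˡ (λ h → ∈∪ʳ (∈∪ʳ h)))) (ρ-mono (λ h → x∈p∩q⁺ (X⊆Z h , ∈∪ˡ h))) ⟩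
      ρ (Z ∪ (X ∪ ⁅ x ⁆)) + ρ (Z ∩ (X ∪ ⁅ x ⁆))
        ≤⟨ rk-submod M Z (X ∪ ⁅ x ⁆) ⟩
      ρ Z + ρ (X ∪ ⁅ x ⁆)
        ≤⟨ +-mono-≤ ρZ≤ρX ρXx≤ρX ⟩
      ρ X + ρ X ∎)
    where open ≤-Reasoning

  ρ-∪-absorbed : ∀ X Y → (∀ {y} → y ∈ Y → ρ (X ∪ ⁅ y ⁆) ≤ ρ X) → ρ (X ∪ Y) ≤ ρ X
  ρ-∪-absorbed X Y = go ∣ Y ∣ Y ≤-refl
    where
    go : ∀ k Y → ∣ Y ∣ ≤ k → (∀ {y} → y ∈ Y → ρ (X ∪ ⁅ y ⁆) ≤ ρ X) → ρ (X ∪ Y) ≤ ρ X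
    go k Y ∣Y∣≤k absorbed with nonempty? Y
    ... | no ¬ne = ≤-reflexive (cong ρ (trans (cong (X ∪_) (Empty-unique ¬ne)) (∪-identityʳ X)))
    go zero    Y ∣Y∣≤k absorbed | yes (y , y∈Y) = ⊥-elim (1+n≰n (≤-trans (∈⇒∣p∣≥1 Y y∈Y) ∣Y∣≤k))
    go (suc k) Y ∣Y∣≤k absorbed | yes (y , y∈Y) =
      ≤-trans (ρ-mono X∪Y⊆) (ρ-∪⁅x⁆-absorbed X (X ∪ (Y - y)) y ∈∪ˡ ih (absorbed y∈Y))
      where
      ih : ρ (X ∪ (Y - y)) ≤ ρ X
      ih = go k (Y - y) (≤-pred (≤-trans (x∈p⇒∣p-x∣<∣p∣ y∈Y) ∣Y∣≤k)) (λ h → absorbed (p─q⊆p Y ⁅ y ⁆ h))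
      X∪Y⊆ : X ∪ Y ⊆ (X ∪ (Y - y)) ∪ ⁅ y ⁆
      X∪Y⊆ {z} z∈ with x∈p∪q⁻ X Y z∈
      ... | inj₁ z∈X = ∈∪ˡ (∈∪ˡ z∈X)
      ... | inj₂ z∈Y with z ≟ᶠ y
      ...   | yes refl = ∈∪ʳ (x∈⁅x⁆ y)
      ...   | no z≢y   = ∈∪ˡ (∈∪ʳ (x∈p∧x≢y⇒x∈p-y z∈Y z≢y))

  cl : Subset n → Subset n
  cl X = tabulate (λ x → does (ρ (X ∪ ⁅ x ⁆) ≤? ρ X))

  ∈cl⁻ : ∀ X {x} → x ∈ cl X → ρ (X ∪ ⁅ x ⁆) ≤ ρ X
  ∈cl⁻ X {x} h = T⇒ (ρ (X ∪ ⁅ x ⁆) ≤? ρ X)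
    (trans (sym (lookup∘tabulate (λ x → does (ρ (X ∪ ⁅ x ⁆) ≤? ρ X)) x)) ([]=⇒lookup h))
    where
    T⇒ : ∀ {A : Set} (d : Dec A) → does d ≡ true → A
    T⇒ (yes a) _ = a

  ∈cl⁺ : ∀ X {x} → ρ (X ∪ ⁅ x ⁆) ≤ ρ X → x ∈ cl X
  ∈cl⁺ X {x} le = lookup⇒[]= x (cl X) (trans (lookup∘tabulate (λ x → does (ρ (X ∪ ⁅ x ⁆) ≤? ρ X)) x) (does-true (ρ (X ∪ ⁅ x ⁆) ≤? ρ X)))
    where
    does-true : (d : Dec (ρ (X ∪ ⁅ x ⁆) ≤ ρ X)) → does d ≡ true
    does-true (yes _) = refl
    does-true (no ¬le) = ⊥-elim (¬le le)

  X⊆clX : ∀ X → X ⊆ cl X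
  X⊆clX X {x} x∈X = ∈cl⁺ X (ρ-mono (∪-least (λ h → h) (λ h → subst (_∈ X) (sym (x∈⁅y⁆⇒x≡y x h)) x∈X)))

  ρ-cl : ∀ X → ρ (cl X) ≡ ρ X
  ρ-cl X = ≤-antisym (≤-trans (ρ-mono ∈∪ʳ) (ρ-∪-absorbed X (cl X) (∈cl⁻ X))) (ρ-mono (X⊆clX X))

  cl-flat : ∀ X → IsFlat M (cl X)
  cl-flat X e e∉ = begin-strict
      ρ (cl X)          ≡⟨ ρ-cl X ⟩
      ρ X               <⟨ ≰⇒> (λ h → e∉ (∈cl⁺ X h)) ⟩
      ρ (X ∪ ⁅ e ⁆)     ≤⟨ ρ-mono (∪-least (λ h → ∈∪ˡ (X⊆clX X h)) ∈∪ʳ) ⟩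
      ρ (cl X ∪ ⁅ e ⁆)  ∎
    where open ≤-Reasoning

  ρ-∪⁅e⁆-below-flat : ∀ e A X → IsFlat M A → e ∉ A → X ⊆ A → ρ X < ρ (X ∪ ⁅ e ⁆)
  ρ-∪⁅e⁆-below-flat e A X A-flat e∉A X⊆A = +-cancelʳ-< (ρ A) _ _ (begin-strict
      ρ X + ρ A                                   <⟨ +-monoʳ-< (ρ X) (A-flat e e∉A) ⟩
      ρ X + ρ (A ∪ ⁅ e ⁆)                         ≤⟨ +-mono-≤ (ρ-mono (λ h → x∈p∩q⁺ (∈∪ˡ h , X⊆A h)))
                                                               (ρ-mono (∪-least ∈∪ʳ (λ h → ∈∪ˡ (∈∪ʳ h)))) ⟩
      ρ ((X ∪ ⁅ e ⁆) ∩ A) + ρ ((X ∪ ⁅ e ⁆) ∪ A)   ≡⟨ +-comm (ρ ((X ∪ ⁅ e ⁆) ∩ A)) _ ⟩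
      ρ ((X ∪ ⁅ e ⁆) ∪ A) + ρ ((X ∪ ⁅ e ⁆) ∩ A)   ≤⟨ rk-submod M (X ∪ ⁅ e ⁆) A ⟩
      ρ (X ∪ ⁅ e ⁆) + ρ A                         ∎)
    where open ≤-Reasoning

  ∩-flat : ∀ A B → IsFlat M A → IsFlat M B → IsFlat M (A ∩ B)
  ∩-flat A B A-flat B-flat e e∉ with e ∈? A
  ... | no e∉A  = ρ-∪⁅e⁆-below-flat e A (A ∩ B) A-flat e∉A (p∩q⊆p A B)
  ... | yes e∈A = ρ-∪⁅e⁆-below-flat e B (A ∩ B) B-flat (λ e∈B → e∉ (x∈p∩q⁺ (e∈A , e∈B))) (p∩q⊆q A B)

  flat-∪-⊈ : ∀ {H K} → IsFlat M H → ¬ (K ⊆ H) → suc (ρ H) ≤ ρ (H ∪ K)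
  flat-∪-⊈ {H} {K} H-flat K⊈H =
    let (e , e∈K , e∉H) = ⊈⇒∃ K H K⊈H in
    ≤-trans (H-flat e e∉H) (ρ-mono (∪-least ∈∪ˡ (λ h → ∈∪ʳ (subst (_∈ K) (sym (x∈⁅y⁆⇒x≡y e h)) e∈K))))

  ρ-∩-of-⊈ : ∀ {H K m} → IsFlat M H → ρ H ≡ suc m → ρ K ≡ suc m → ¬ (K ⊆ H) → ρ (H ∩ K) ≤ m
  ρ-∩-of-⊈ {H} {K} {m} H-flat ρH≡ ρK≡ K⊈H = ≤-pred (+-cancelˡ-≤ (suc m) _ _ (begin
      suc m + suc (ρ (H ∩ K))   ≡⟨ +-suc (suc m) _ ⟩
      suc (suc m) + ρ (H ∩ K)   ≤⟨ +-monoˡ-≤ _ (subst (λ k → suc k ≤ ρ (H ∪ K)) ρH≡ (flat-∪-⊈ H-flat K⊈H)) ⟩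
      ρ (H ∪ K) + ρ (H ∩ K)     ≤⟨ rk-submod M H K ⟩
      ρ H + ρ K                 ≡⟨ cong₂ _+_ ρH≡ ρK≡ ⟩
      suc m + suc m             ∎))
    where open ≤-Reasoning

  -- Each line shares the non-loop a with what has been added so far, so by submodularity it raises the rank by at most one.
  ρ-∪-lines≤ : ∀ {m} (L : Fin m → Subset n) a → 1 ≤ ρ ⁅ a ⁆ → (∀ i → ρ (L i) ≤ 2) → (∀ i → a ∈ L i) →
    ∀ K Y → a ∈ Y → ρ (Y ∪ bigUnion L K) ≤ ρ Y + ∣ K ∣
  ρ-∪-lines≤ {zero} L a _ _ _ [] Y a∈Y = ≤-reflexive (trans (cong ρ (∪-identityʳ Y)) (sym (+-identityʳ _)))
  ρ-∪-lines≤ {suc m} L a a-nonloop ρL≤2 a∈L (true ∷ K) Y a∈Y = begin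
      ρ (Y ∪ (L fzero ∪ U))     ≡⟨ cong ρ (∪-assoc Y (L fzero) U) ⟨
      ρ ((Y ∪ L fzero) ∪ U)     ≤⟨ ρ-∪-lines≤ (λ i → L (fsuc i)) a a-nonloop (λ i → ρL≤2 (fsuc i)) (λ i → a∈L (fsuc i))
                                                K (Y ∪ L fzero) (∈∪ˡ a∈Y) ⟩
      ρ (Y ∪ L fzero) + ∣ K ∣   ≤⟨ +-monoˡ-≤ ∣ K ∣ one-more ⟩
      ρ Y + 1 + ∣ K ∣           ≡⟨ +-assoc (ρ Y) 1 ∣ K ∣ ⟩
      ρ Y + suc ∣ K ∣           ∎
    where
    open ≤-Reasoning
    U = bigUnion (λ i → L (fsuc i)) K
    one-more : ρ (Y ∪ L fzero) ≤ ρ Y + 1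
    one-more = +-cancelʳ-≤ 1 _ _ (begin
        ρ (Y ∪ L fzero) + 1
          ≤⟨ +-monoʳ-≤ (ρ (Y ∪ L fzero)) (≤-trans a-nonloop
               (ρ-mono (λ {x} x∈ → subst (_∈ Y ∩ L fzero) (sym (x∈⁅y⁆⇒x≡y a x∈)) (x∈p∩q⁺ (a∈Y , a∈L fzero))))) ⟩
        ρ (Y ∪ L fzero) + ρ (Y ∩ L fzero)  ≤⟨ rk-submod M Y (L fzero) ⟩
        ρ Y + ρ (L fzero)                  ≤⟨ +-monoʳ-≤ (ρ Y) (ρL≤2 fzero) ⟩
        ρ Y + 2                            ≡⟨ +-assoc (ρ Y) 1 1 ⟨
        ρ Y + 1 + 1                        ∎)
  ρ-∪-lines≤ {suc m} L a a-nonloop ρL≤2 a∈L (false ∷ K) Y a∈Y =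
    ρ-∪-lines≤ (λ i → L (fsuc i)) a a-nonloop (λ i → ρL≤2 (fsuc i)) (λ i → a∈L (fsuc i)) K Y a∈Y

  -- Each h i together with the intersection of the others covers ⊤, so by submodularity every further
  -- intersection lowers the rank by at least one.
  ρ-bigInter+∣S∣≤ : ∀ {m r} → ρ ⊤ ≡ r → (h : Fin m → Subset n) → (∀ i → suc (ρ (h i)) ≤ r) →
    (∀ i j → i ≢ j → ∀ x → x ∉ h i → x ∈ h j) → ∀ S → ρ (bigInter h S) + ∣ S ∣ ≤ r
  ρ-bigInter+∣S∣≤ {zero} ρ⊤≡r h hr hc [] = ≤-reflexive (trans (+-identityʳ _) ρ⊤≡r)
  ρ-bigInter+∣S∣≤ {suc m} ρ⊤≡r h hr hc (false ∷ S) =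
    ρ-bigInter+∣S∣≤ ρ⊤≡r (λ i → h (fsuc i)) (λ i → hr (fsuc i)) (λ i j i≢j → hc (fsuc i) (fsuc j) (λ e → i≢j (fsuc-injective e))) S
  ρ-bigInter+∣S∣≤ {suc m} {r} ρ⊤≡r h hr hc (true ∷ S) = +-cancelˡ-≤ r _ _ (begin
      r + (ρ (h fzero ∩ X) + suc ∣ S ∣)                   ≤⟨ +-monoˡ-≤ _ (≤-trans (≤-reflexive (sym ρ⊤≡r)) (ρ-mono covers)) ⟩
      ρ (h fzero ∪ X) + (ρ (h fzero ∩ X) + suc ∣ S ∣)     ≡⟨ +-assoc (ρ (h fzero ∪ X)) _ _ ⟨
      (ρ (h fzero ∪ X) + ρ (h fzero ∩ X)) + suc ∣ S ∣     ≤⟨ +-monoˡ-≤ _ (rk-submod M (h fzero) X) ⟩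
      (ρ (h fzero) + ρ X) + suc ∣ S ∣                     ≡⟨ rearrange (ρ (h fzero)) (ρ X) ∣ S ∣ ⟩
      suc (ρ (h fzero)) + (ρ X + ∣ S ∣)                   ≤⟨ +-mono-≤ (hr fzero) ih ⟩
      r + r                                               ∎)
    where
    open ≤-Reasoning
    X = bigInter (λ i → h (fsuc i)) S
    rearrange : ∀ a b c → (a + b) + suc c ≡ suc a + (b + c)
    rearrange = solve-∀
    ih : ρ X + ∣ S ∣ ≤ r
    ih = ρ-bigInter+∣S∣≤ ρ⊤≡r (λ i → h (fsuc i)) (λ i → hr (fsuc i)) (λ i j i≢j → hc (fsuc i) (fsuc j) (λ e → i≢j (fsuc-injective e))) S
    covers : ⊤ ⊆ h fzero ∪ X
    covers {x} _ with x ∈? h fzero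
    ... | yes x∈h = ∈∪ˡ x∈h
    ... | no x∉h  = ∈∪ʳ (∈bigInter⁺ (λ i → h (fsuc i)) S (λ i _ → hc fzero (fsuc i) (λ ()) x x∉h))

FlatSizeBound : ∀ {n} → Matroid n → (r t : ℕ) → Set
FlatSizeBound {n} M r t =
  ∀ (i : ℕ) (X : Subset n) → 1 ≤ i → i ≤ r → IsFlat M X → rk M X ≡ i → ∣ X ∣ ≤ (i ∸ 1) * t + 1

module SizeBounded {n : ℕ} (M : Matroid n) (r t : ℕ) (2≤r : 2 ≤ r) (1≤t : 1 ≤ t)
  (ρ⊤≡r : rk M ⊤ ≡ r) (bound : FlatSizeBound M r t) where

  open RankFacts M public

  private
    ∃-nonloop : ∃ λ x → ρ ⁅ x ⁆ ≡ 1
    ∃-nonloop with any? (λ x → ρ ⁅ x ⁆ ≟ 1)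
    ... | yes w = w
    ... | no ¬w = ⊥-elim (2≰0 (begin
        2              ≤⟨ 2≤r ⟩
        r              ≡⟨ ρ⊤≡r ⟨
        ρ ⊤            ≡⟨ cong ρ (∪-identityˡ ⊤) ⟨
        ρ (⊥ ∪ ⊤)      ≤⟨ ρ-∪-absorbed ⊥ ⊤ loop ⟩
        ρ ⊥            ≡⟨ ρ⊥≡0 ⟩
        0              ∎))
      where
      open ≤-Reasoning
      2≰0 : ¬ (2 ≤ 0)
      2≰0 ()
      loop : ∀ {y} → y ∈ ⊤ → ρ (⊥ ∪ ⁅ y ⁆) ≤ ρ ⊥
      loop {y} _ = subst₂ _≤_ (cong ρ (sym (∪-identityˡ ⁅ y ⁆))) (sym ρ⊥≡0)
        (≤-pred (≤∧≢⇒< (ρ⁅x⁆≤1 y) (λ e → ¬w (y , e))))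

  -- A rank-0 set misses some non-loop f, and X ∪ {f} spans a rank-1 flat, which has at most one element.
  ρ≡0⇒∣∣≡0 : ∀ X → ρ X ≡ 0 → ∣ X ∣ ≡ 0
  ρ≡0⇒∣∣≡0 X ρX≡0 = n≤0⇒n≡0 (≤-pred (begin
      suc ∣ X ∣     ≡⟨ ∣p∪⁅x⁆∣≡1+∣p∣ X f f∉X ⟨
      ∣ X ∪ ⁅ f ⁆ ∣  ≤⟨ p⊆q⇒∣p∣≤∣q∣ (X⊆clX (X ∪ ⁅ f ⁆)) ⟩
      ∣ cl (X ∪ ⁅ f ⁆) ∣
        ≤⟨ bound 1 (cl (X ∪ ⁅ f ⁆)) ≤-refl (≤-trans (s≤s z≤n) 2≤r) (cl-flat _) (trans (ρ-cl _) ρXf≡1) ⟩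
      1              ∎))
    where
    open ≤-Reasoning
    f = proj₁ ∃-nonloop
    ρf≡1 = proj₂ ∃-nonloop
    f∉X : f ∉ X
    f∉X f∈X = 1+n≰n (≤-trans (≤-reflexive (sym ρf≡1))
      (≤-trans (ρ-mono (λ h → subst (_∈ X) (sym (x∈⁅y⁆⇒x≡y f h)) f∈X)) (≤-reflexive ρX≡0)))
    ρXf≡1 : ρ (X ∪ ⁅ f ⁆) ≡ 1
    ρXf≡1 = ≤-antisym (≤-trans (ρ-∪≤ X ⁅ f ⁆) (≤-reflexive (cong₂ _+_ ρX≡0 ρf≡1)))
                      (≤-trans (≤-reflexive (sym ρf≡1)) (ρ-mono ∈∪ʳ))

  ρ≡1+i⇒∣∣≤ : ∀ X i → ρ X ≡ suc i → ∣ X ∣ ≤ i * t + 1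
  ρ≡1+i⇒∣∣≤ X i ρX≡1+i = ≤-trans (p⊆q⇒∣p∣≤∣q∣ (X⊆clX X))
    (bound (suc i) (cl X) (s≤s z≤n) (≤-trans (≤-reflexive (sym ρX≡1+i)) (≤-trans (ρ-mono ⊆⊤) (≤-reflexive ρ⊤≡r)))
           (cl-flat X) (trans (ρ-cl X) ρX≡1+i))

  ρ≤1+i⇒∣∣≤ : ∀ X i → ρ X ≤ suc i → ∣ X ∣ ≤ i * t + 1
  ρ≤1+i⇒∣∣≤ X i ρX≤1+i with ρ X in eq
  ... | zero  = ≤-trans (≤-reflexive (ρ≡0⇒∣∣≡0 X eq)) z≤n
  ... | suc j = ≤-trans (ρ≡1+i⇒∣∣≤ X j eq) (+-monoˡ-≤ 1 (*-monoˡ-≤ t (≤-pred ρX≤1+i)))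

  ∣∣≡kt+1⇒ρ>k : ∀ X k → ∣ X ∣ ≡ k * t + 1 → suc k ≤ ρ X
  ∣∣≡kt+1⇒ρ>k X k ∣X∣≡ with suc k ≤? ρ X
  ... | yes k<ρX = k<ρX
  ... | no k≮ρX with k
  ...   | zero  = ⊥-elim (0≢1+n (trans (sym (ρ≡0⇒∣∣≡0 X (n≤0⇒n≡0 (≤-pred (≰⇒> k≮ρX))))) ∣X∣≡))
  ...   | suc j = ⊥-elim (<⇒≱ ∣X∣< (≤-reflexive (sym ∣X∣≡)))
    where
    ∣X∣< : ∣ X ∣ < suc j * t + 1
    ∣X∣< = ≤-trans (s≤s (ρ≤1+i⇒∣∣≤ X j (≤-pred (≰⇒> k≮ρX)))) (+-monoˡ-≤ 1 (+-monoˡ-≤ (j * t) 1≤t))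

  ρ⁅x⁆≡1 : ∀ x → ρ ⁅ x ⁆ ≡ 1
  ρ⁅x⁆≡1 x = ≤-antisym (ρ⁅x⁆≤1 x) (∣∣≡kt+1⇒ρ>k ⁅ x ⁆ 0 (∣⁅x⁆∣≡1 x))

  ρ⁅x,y⁆≡2 : ∀ x y → x ≢ y → ρ (⁅ x ⁆ ∪ ⁅ y ⁆) ≡ 2
  ρ⁅x,y⁆≡2 x y x≢y = ≤-antisym (≤-trans (ρ-∪≤ ⁅ x ⁆ ⁅ y ⁆) (≤-reflexive (cong₂ _+_ (ρ⁅x⁆≡1 x) (ρ⁅x⁆≡1 y))))
    (≮⇒≥ λ ρ<2 → 1+n≰n (≤-trans (≤-reflexive (sym ∣⁅x,y⁆∣≡2)) (ρ≤1+i⇒∣∣≤ (⁅ x ⁆ ∪ ⁅ y ⁆) 0 (≤-pred ρ<2))))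
    where
    ∣⁅x,y⁆∣≡2 : ∣ ⁅ x ⁆ ∪ ⁅ y ⁆ ∣ ≡ 2
    ∣⁅x,y⁆∣≡2 = trans (∣p∪⁅x⁆∣≡1+∣p∣ ⁅ x ⁆ y (λ h → x≢y (sym (x∈⁅y⁆⇒x≡y x h)))) (cong suc (∣⁅x⁆∣≡1 x))

  ⁅x⁆-flat : ∀ x → IsFlat M ⁅ x ⁆
  ⁅x⁆-flat x y y∉ = ≤-trans (s≤s (≤-reflexive (ρ⁅x⁆≡1 x)))
    (≤-reflexive (sym (ρ⁅x,y⁆≡2 x y (λ eq → y∉ (subst (_∈ ⁅ x ⁆) eq (x∈⁅x⁆ x))))))

  ⊥-flat : IsFlat M ⊥
  ⊥-flat x _ = ≤-trans (s≤s (≤-reflexive ρ⊥≡0)) (≤-trans (≤-reflexive (sym (ρ⁅x⁆≡1 x))) (ρ-mono ∈∪ʳ))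

-- Counting flags

Σᴸ-allSubsets≡Σˢ : ∀ n (f : Subset n → ℕ) → Σᴸ (allSubsets n) f ≡ Σˢ f
Σᴸ-allSubsets≡Σˢ zero    f = +-identityʳ _
Σᴸ-allSubsets≡Σˢ (suc n) f = trans (Σᴸ-++ (map (true ∷_) (allSubsets n)) _ f)
  (cong₂ _+_ (trans (Σᴸ-map (true ∷_) (allSubsets n) f) (Σᴸ-allSubsets≡Σˢ n _))
             (trans (Σᴸ-map (false ∷_) (allSubsets n) f) (Σᴸ-allSubsets≡Σˢ n _)))

Σᴸ-allVecs-∷ : ∀ (xs : List T) k (f : Vec T (suc k) → ℕ) →
  Σᴸ (allVecs xs (suc k)) f ≡ Σᴸ xs (λ x → Σᴸ (allVecs xs k) (λ v → f (x ∷ v)))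
Σᴸ-allVecs-∷ xs k f = trans (Σᴸ-concatMap (λ x → map (x ∷_) (allVecs xs k)) xs f)
  (Σᴸ-cong xs (λ x → Σᴸ-map (x ∷_) (allVecs xs k) f))

Σᴸ-allVecs-∷ʳ : ∀ (xs : List T) k (f : Vec T (suc k) → ℕ) →
  Σᴸ (allVecs xs (suc k)) f ≡ Σᴸ (allVecs xs k) (λ u → Σᴸ xs (λ y → f (u ∷ʳ y)))
Σᴸ-allVecs-∷ʳ xs zero f =
  trans (Σᴸ-allVecs-∷ xs 0 f) (trans (Σᴸ-cong xs (λ x → +-identityʳ _)) (sym (+-identityʳ _)))
Σᴸ-allVecs-∷ʳ xs (suc k) f = trans (Σᴸ-allVecs-∷ xs (suc k) f)
  (trans (Σᴸ-cong xs (λ x → Σᴸ-allVecs-∷ʳ xs k (λ v → f (x ∷ v))))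
         (sym (Σᴸ-allVecs-∷ xs k (λ u → Σᴸ xs (λ y → f (u ∷ʳ y))))))

lookup-∷ʳ-inject₁ : ∀ {m} (u : Vec T m) y (i : Fin m) → lookup (u ∷ʳ y) (inject₁ i) ≡ lookup u i
lookup-∷ʳ-inject₁ (x ∷ u) y fzero    = refl
lookup-∷ʳ-inject₁ (x ∷ u) y (fsuc i) = lookup-∷ʳ-inject₁ u y i

lookup-∷ʳ-last : ∀ {m} (u : Vec T m) y → lookup (u ∷ʳ y) (fromℕ m) ≡ y
lookup-∷ʳ-last []      y = refl
lookup-∷ʳ-last (x ∷ u) y = lookup-∷ʳ-last u y

inject₁-or-last : ∀ {m} (j : Fin (suc m)) → (∃ λ i → j ≡ inject₁ i) ⊎ j ≡ fromℕ m
inject₁-or-last {zero}  fzero    = inj₂ refl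
inject₁-or-last {suc m} fzero    = inj₁ (fzero , refl)
inject₁-or-last {suc m} (fsuc j) with inject₁-or-last j
... | inj₁ (i , e) = inj₁ (fsuc i , cong fsuc e)
... | inj₂ e       = inj₂ (cong fsuc e)

module FlagCount {n : ℕ} (M : Matroid n) (t : ℕ) where

  largeSize : ℕ → ℕ
  largeSize zero    = 0
  largeSize (suc j) = j * t + 1

  IsLarge : ℕ → Subset n → Set
  IsLarge i X = IsFlat M X × rk M X ≡ i × ∣ X ∣ ≡ largeSize i

  large? : ∀ i X → Dec (IsLarge i X)
  large? i X = isFlat? M X ×-dec ((rk M X ≟ i) ×-dec (∣ X ∣ ≟ largeSize i))

  #flagsTo : ℕ → Subset n → ℕ
  #flagsTo zero    G = χ (large? 0 G)
  #flagsTo (suc k) G = χ (large? (suc k) G) * Σˢ (λ H → χ (H ⊂? G) * #flagsTo k H)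

  sizes : ∀ k → Fin (suc k) → ℕ
  sizes k i = largeSize (toℕ i)

  private
    IsLarge-subst : ∀ {i j X Y} → i ≡ j → X ≡ Y → IsLarge i X → IsLarge j Y
    IsLarge-subst refl refl large = large

  IsFlagChain-∷ʳ⁻ : ∀ k u y → IsFlagChain M (suc k) (sizes (suc k)) (u ∷ʳ y) →
    IsFlagChain M k (sizes k) u × IsLarge (suc k) y × lookup u (fromℕ k) ⊂ y
  IsFlagChain-∷ʳ⁻ k u y (large , ⊂next) =
      ((λ i → IsLarge-subst (toℕ-inject₁ i) (lookup-∷ʳ-inject₁ u y i) (large (inject₁ i))) ,
       (λ i → subst₂ _⊂_ (lookup-∷ʳ-inject₁ u y (inject₁ i)) (lookup-∷ʳ-inject₁ u y (fsuc i)) (⊂next (inject₁ i))))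
    , IsLarge-subst (toℕ-fromℕ (suc k)) (lookup-∷ʳ-last u y) (large (fromℕ (suc k)))
    , subst₂ _⊂_ (lookup-∷ʳ-inject₁ u y (fromℕ k)) (lookup-∷ʳ-last u y) (⊂next (fromℕ k))

  IsFlagChain-∷ʳ⁺ : ∀ k u y → IsFlagChain M k (sizes k) u → IsLarge (suc k) y → lookup u (fromℕ k) ⊂ y →
    IsFlagChain M (suc k) (sizes (suc k)) (u ∷ʳ y)
  IsFlagChain-∷ʳ⁺ k u y (large , ⊂next) large-y top⊂y = large′ , ⊂next′
    where
    large′ : ∀ j → IsLarge (toℕ j) (lookup (u ∷ʳ y) j)
    large′ j with inject₁-or-last j
    ... | inj₁ (i , refl) = IsLarge-subst (sym (toℕ-inject₁ i)) (sym (lookup-∷ʳ-inject₁ u y i)) (large i)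
    ... | inj₂ refl       = IsLarge-subst (sym (toℕ-fromℕ (suc k))) (sym (lookup-∷ʳ-last u y)) large-y
    ⊂next′ : ∀ j → lookup (u ∷ʳ y) (inject₁ j) ⊂ lookup (u ∷ʳ y) (fsuc j)
    ⊂next′ j with inject₁-or-last j
    ... | inj₁ (i , refl) =
      subst₂ _⊂_ (sym (lookup-∷ʳ-inject₁ u y (inject₁ i))) (sym (lookup-∷ʳ-inject₁ u y (fsuc i))) (⊂next i)
    ... | inj₂ refl = subst₂ _⊂_ (sym (lookup-∷ʳ-inject₁ u y (fromℕ k))) (sym (lookup-∷ʳ-last u y)) top⊂y

  χ-IsFlagChain-∷ʳ : ∀ k u y → χ (isFlagChain? M (suc k) (sizes (suc k)) (u ∷ʳ y)) ≡
    χ (isFlagChain? M k (sizes k) u) * (χ (large? (suc k) y) * χ (lookup u (fromℕ k) ⊂? y))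
  χ-IsFlagChain-∷ʳ k u y = sym (trans
    (cong (χ (isFlagChain? M k (sizes k) u) *_)
      (χ*χ≡χ (large? (suc k) y) (lookup u (fromℕ k) ⊂? y) (large? (suc k) y ×-dec (lookup u (fromℕ k) ⊂? y)) _,_ proj₁ proj₂))
    (χ*χ≡χ (isFlagChain? M k (sizes k) u) (large? (suc k) y ×-dec (lookup u (fromℕ k) ⊂? y))
       (isFlagChain? M (suc k) (sizes (suc k)) (u ∷ʳ y))
       (λ c (l , s) → IsFlagChain-∷ʳ⁺ k u y c l s)
       (λ c → proj₁ (IsFlagChain-∷ʳ⁻ k u y c)) (λ c → proj₂ (IsFlagChain-∷ʳ⁻ k u y c))))

  private
    chains = allVecs (allSubsets n)

  -- Weighted by an arbitrary function of the top flat, so that peeling off the top flat is an induction.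
  Σchains≡Σ#flagsTo : ∀ k (g : Subset n → ℕ) →
    Σᴸ (chains (suc k)) (λ v → χ (isFlagChain? M k (sizes k) v) * g (lookup v (fromℕ k)))
    ≡ Σˢ (λ G → #flagsTo k G * g G)
  Σchains≡Σ#flagsTo zero g =
    trans (Σᴸ-allVecs-∷ (allSubsets n) 0 _) (trans (Σᴸ-cong (allSubsets n) single) (Σᴸ-allSubsets≡Σˢ n _))
    where
    single : ∀ x → χ (isFlagChain? M 0 (sizes 0) (x ∷ [])) * g x + 0 ≡ #flagsTo 0 x * g x
    single x = trans (+-identityʳ _) (cong (_* g x) (χ-cong (isFlagChain? M 0 (sizes 0) (x ∷ [])) (large? 0 x)
      (λ c → proj₁ c fzero) (λ l → (λ { fzero → l }) , λ ())))
  Σchains≡Σ#flagsTo (suc k) g = begin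
      Σᴸ (chains (suc (suc k))) (λ v → χ (chain? (suc k) v) * g (lookup v (fromℕ (suc k))))
    ≡⟨ Σᴸ-allVecs-∷ʳ (allSubsets n) (suc k) _ ⟩
      Σᴸ (chains (suc k)) (λ u → Σᴸ (allSubsets n) (λ y → χ (chain? (suc k) (u ∷ʳ y)) * g (lookup (u ∷ʳ y) (fromℕ (suc k)))))
    ≡⟨ Σᴸ-cong (chains (suc k)) (λ u → trans (Σᴸ-allSubsets≡Σˢ n _) (trans (Σˢ-cong (λ y → split u y))
         (Σˢ-*ˡ (χ (chain? k u)) (λ y → (χ (large? (suc k) y) * χ (lookup u (fromℕ k) ⊂? y)) * g y)))) ⟩
      Σᴸ (chains (suc k)) (λ u → χ (chain? k u) * h (lookup u (fromℕ k)))
    ≡⟨ Σchains≡Σ#flagsTo k h ⟩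
      Σˢ (λ H → #flagsTo k H * h H)
    ≡⟨ Σˢ-cong (λ H → Σˢ-*ˡ {n} (#flagsTo k H) _) ⟨
      Σˢ (λ H → Σˢ (λ y → #flagsTo k H * ((χ (large? (suc k) y) * χ (H ⊂? y)) * g y)))
    ≡⟨ Σˢ-comm {n} {n} _ ⟩
      Σˢ (λ y → Σˢ (λ H → #flagsTo k H * ((χ (large? (suc k) y) * χ (H ⊂? y)) * g y)))
    ≡⟨ Σˢ-cong (λ y → trans (Σˢ-cong (λ H → reorder (#flagsTo k H) (χ (large? (suc k) y)) (χ (H ⊂? y)) (g y)))
         (trans (Σˢ-*ˡ {n} (χ (large? (suc k) y) * g y) _) (reorder′ (χ (large? (suc k) y)) (g y) _))) ⟩
      Σˢ (λ G → #flagsTo (suc k) G * g G) ∎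
    where
    open ≡-Reasoning
    chain? : ∀ k v → Dec (IsFlagChain M k (sizes k) v)
    chain? k = isFlagChain? M k (sizes k)
    h : Subset n → ℕ
    h H = Σˢ (λ y → (χ (large? (suc k) y) * χ (H ⊂? y)) * g y)
    split : ∀ u y → χ (chain? (suc k) (u ∷ʳ y)) * g (lookup (u ∷ʳ y) (fromℕ (suc k)))
                  ≡ χ (chain? k u) * ((χ (large? (suc k) y) * χ (lookup u (fromℕ k) ⊂? y)) * g y)
    split u y = trans (cong₂ _*_ (χ-IsFlagChain-∷ʳ k u y) (cong g (lookup-∷ʳ-last u y)))
      (*-assoc (χ (chain? k u)) (χ (large? (suc k) y) * χ (lookup u (fromℕ k) ⊂? y)) (g y))
    reorder : ∀ (a b c d : ℕ) → a * ((b * c) * d) ≡ (b * d) * (c * a)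
    reorder = solve-∀
    reorder′ : ∀ (b d s : ℕ) → (b * d) * s ≡ (b * s) * d
    reorder′ = solve-∀

count : ∀ {n} {Pr : Subset n → Set} → (∀ X → Dec (Pr X)) → ℕ
count P? = Σˢ (λ X → χ (P? X))

count-≤-injection : ∀ {n} {Pr Qr : Subset n → Set} (P? : ∀ X → Dec (Pr X)) (Q? : ∀ X → Dec (Qr X))
  (φ : Subset n → Subset n) → (∀ K → Pr K → Qr (φ K)) → (∀ K K′ → Pr K → Pr K′ → φ K ≡ φ K′ → K ≡ K′) →
  count P? ≤ count Q?
count-≤-injection {n} {Pr} {Qr} P? Q? φ φ-maps φ-injective = begin
    Σˢ (λ K → χ (P? K))
  ≡⟨ Σˢ-cong (λ K → trans (cong (χ (P? K) *_) (Σˢχ≡ (φ K))) (*-identityʳ _)) ⟨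
    Σˢ (λ K → χ (P? K) * Σˢ (λ Y → χ (Y ≟ˢ φ K)))
  ≡⟨ Σˢ-cong (λ K → Σˢ-*ˡ {n} (χ (P? K)) (λ Y → χ (Y ≟ˢ φ K))) ⟨
    Σˢ (λ K → Σˢ (λ Y → χ (P? K) * χ (Y ≟ˢ φ K)))
  ≡⟨ Σˢ-comm {n} {n} _ ⟩
    Σˢ (λ Y → Σˢ (λ K → χ (P? K) * χ (Y ≟ˢ φ K)))
  ≤⟨ Σˢ-mono fibre≤1 ⟩
    Σˢ (λ K → χ (Q? K)) ∎
  where
  open ≤-Reasoning
  fibre≤1 : ∀ Y → Σˢ (λ K → χ (P? K) * χ (Y ≟ˢ φ K)) ≤ χ (Q? Y)
  fibre≤1 Y with Q? Y
  ... | yes _ = Σˢ≤1 _ (λ K → χ*χ≤1 (P? K) (Y ≟ˢ φ K))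
      (λ K K′ h h′ → let (pK , Y≡φK) = χ*χ>0⇒ (P? K) (Y ≟ˢ φ K) h
                         (pK′ , Y≡φK′) = χ*χ>0⇒ (P? K′) (Y ≟ˢ φ K′) h′
                     in φ-injective K K′ pK pK′ (trans (sym Y≡φK) Y≡φK′))
  ... | no ¬qY = ≤-reflexive (Σˢ-zero _ (λ K → ≯0⇒≡0 (λ h →
      let (pK , Y≡φK) = χ*χ>0⇒ (P? K) (Y ≟ˢ φ K) h in ¬qY (subst Qr (sym Y≡φK) (φ-maps K pK)))))

≤count-injection : ∀ {n m} {Qr : Subset n → Set} (Q? : ∀ X → Dec (Qr X)) (f : Fin m → Subset n) →
  (∀ i → Qr (f i)) → (∀ i j → f i ≡ f j → i ≡ j) → m ≤ count Q?
≤count-injection {n} {m} {Qr} Q? f f-maps f-injective = begin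
    m
  ≡⟨ trans (Σᶠ-const {m} 1) (*-identityʳ m) ⟨
    Σᶠ {m} (λ _ → 1)
  ≡⟨ Σᶠ-cong (λ i → Σˢχ≡ (f i)) ⟨
    Σᶠ (λ i → Σˢ (λ Y → χ (Y ≟ˢ f i)))
  ≡⟨ Σᶠ-Σˢ-comm {m} {n} _ ⟩
    Σˢ (λ Y → Σᶠ (λ i → χ (Y ≟ˢ f i)))
  ≤⟨ Σˢ-mono fibre≤1 ⟩
    Σˢ (λ K → χ (Q? K)) ∎
  where
  open ≤-Reasoning
  fibre≤1 : ∀ Y → Σᶠ (λ i → χ (Y ≟ˢ f i)) ≤ χ (Q? Y)
  fibre≤1 Y with Q? Y
  ... | yes _ = Σᶠ≤1 _ (λ i → χ≤1 (Y ≟ˢ f i))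
      (λ i j h h′ → f-injective i j (trans (sym (χ>0⇒ (Y ≟ˢ f i) h)) (χ>0⇒ (Y ≟ˢ f j) h′)))
  ... | no ¬qY = ≤-reflexive (Σᶠ-zero _ (λ i → ≯0⇒≡0 (λ h → ¬qY (subst Qr (sym (χ>0⇒ (Y ≟ˢ f i) h)) (f-maps i)))))

allSubsets-unique : ∀ n → Unique (allSubsets n)
allSubsets-unique zero    = [] ∷ []
allSubsets-unique (suc n) =
  ++⁺ (map⁺ (cong Data.Vec.tail) (allSubsets-unique n)) (map⁺ (cong Data.Vec.tail) (allSubsets-unique n)) disjoint
  where
  disjoint : ∀ {v} → ¬ (v ∈ᴸ map (true ∷_) (allSubsets n) × v ∈ᴸ map (false ∷_) (allSubsets n))
  disjoint (a , b) with ∈-map⁻ (true ∷_) a | ∈-map⁻ (false ∷_) b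
  ... | (x , _ , refl) | (y , _ , ())

lookup-injective : ∀ {xs : List T} → Unique xs → ∀ i j → Data.List.lookup xs i ≡ Data.List.lookup xs j → i ≡ j
lookup-injective (h ∷ u) fzero    fzero    e = refl
lookup-injective (h ∷ u) fzero    (fsuc j) e = ⊥-elim (All-lookup h (∈-lookup j) e)
lookup-injective (h ∷ u) (fsuc i) fzero    e = ⊥-elim (All-lookup h (∈-lookup i) (sym e))
lookup-injective (h ∷ u) (fsuc i) (fsuc j) e = cong fsuc (lookup-injective u i j e)

count-enumeration : ∀ {n} {Pr : Subset n → Set} (P? : ∀ X → Dec (Pr X)) m → count P? ≡ m →
  Σ (Fin m → Subset n) (λ f → (∀ i → Pr (f i)) × (∀ i j → f i ≡ f j → i ≡ j))
count-enumeration {n} {Pr} P? m count≡m = subst Enumeration length≡m (Data.List.lookup Ps , Ps-valid , Ps-injective)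
  where
  Enumeration : ℕ → Set
  Enumeration k = Σ (Fin k → Subset n) (λ f → (∀ i → Pr (f i)) × (∀ i j → f i ≡ f j → i ≡ j))
  Ps = filter P? (allSubsets n)
  length≡m : length Ps ≡ m
  length≡m = trans (length-filter≡Σᴸχ P? (allSubsets n)) (trans (Σᴸ-allSubsets≡Σˢ n _) count≡m)
  Ps-valid : ∀ i → Pr (Data.List.lookup Ps i)
  Ps-valid i = proj₂ (∈-filter⁻ P? {xs = allSubsets n} (∈-lookup {xs = Ps} i))
  Ps-injective : ∀ i j → Data.List.lookup Ps i ≡ Data.List.lookup Ps j → i ≡ j
  Ps-injective = lookup-injective (filter⁺ P? {xs = allSubsets n} (allSubsets-unique n))

t*N≤mt+1⇒N≤m : ∀ N m t → 2 ≤ t → t * N ≤ m * t + 1 → N ≤ m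
t*N≤mt+1⇒N≤m N m t 2≤t tN≤mt+1 = ≮⇒≥ λ m<N → <⇒≱ (begin-strict
    m * t + 1  <⟨ +-monoʳ-< (m * t) 2≤t ⟩
    m * t + t  ≡⟨ trans (+-comm (m * t) t) (trans (cong (t +_) (*-comm m t)) (sym (*-suc t m))) ⟩
    t * suc m  ≤⟨ *-monoʳ-≤ t m<N ⟩
    t * N      ∎) tN≤mt+1
  where open ≤-Reasoning

-- Large flags and large hyperplanes

module LargeFlags {n : ℕ} (M : Matroid n) (r t : ℕ) (2≤r : 2 ≤ r) (2≤t : 2 ≤ t)
  (ρ⊤≡r : rk M ⊤ ≡ r) (bound : FlatSizeBound M r t) where

  1≤t : 1 ≤ t
  1≤t = ≤-trans (s≤s z≤n) 2≤t

  open SizeBounded M r t 2≤r 1≤t ρ⊤≡r bound public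
  open FlagCount M t public

  LargeIn : Subset n → ℕ → Subset n → Set
  LargeIn G m H = H ⊆ G × IsLarge m H

  largeIn? : ∀ G m H → Dec (LargeIn G m H)
  largeIn? G m H = (H ⊆? G) ×-dec large? m H

  #largeIn : Subset n → ℕ → ℕ
  #largeIn G m = count (largeIn? G m)

  largeSize-< : ∀ k → largeSize (suc k) < largeSize (suc (suc k))
  largeSize-< k = +-monoˡ-≤ 1 (+-monoˡ-≤ (k * t) 1≤t)

  largeSize-sum : ∀ j → largeSize (suc (suc (suc j))) + largeSize (suc j) ≡ largeSize (suc (suc j)) + largeSize (suc (suc j))
  largeSize-sum j = identity j t
    where
    identity : ∀ j t → suc (suc j) * t + 1 + (j * t + 1) ≡ (suc j * t + 1) + (suc j * t + 1)
    identity = solve-∀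

  largeSize-gap : ∀ j x → largeSize (suc (suc (suc j))) ≡ largeSize (suc (suc j)) + x → x ≡ t
  largeSize-gap j x e = +-cancelˡ-≡ (suc j * t + 1) x t (trans (sym e) (identity j t))
    where
    identity : ∀ j t → suc (suc j) * t + 1 ≡ (suc j * t + 1) + t
    identity = solve-∀

  distinct-large⇒⊈ : ∀ {m H K} → IsLarge m H → IsLarge m K → H ≢ K → ¬ (K ⊆ H)
  distinct-large⇒⊈ (_ , _ , ∣H∣≡) (_ , _ , ∣K∣≡) H≢K K⊆H = H≢K (sym (p⊆q∧∣q∣≤∣p∣⇒p≡q K⊆H (≤-reflexive (trans ∣H∣≡ (sym ∣K∣≡)))))

  -- H ∩ K has rank at most j + 1, hence at most jt + 1 elements, so |H ∪ K| ≥ |G| by inclusion–exclusion.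
  large-hyperplanes-cover : ∀ j G H K → ∣ G ∣ ≡ largeSize (suc (suc (suc j))) →
    LargeIn G (suc (suc j)) H → LargeIn G (suc (suc j)) K → H ≢ K → H ∪ K ≡ G
  large-hyperplanes-cover j G H K ∣G∣≡ (H⊆G , H-large) (K⊆G , K-large) H≢K =
    p⊆q∧∣q∣≤∣p∣⇒p≡q (∪-least H⊆G K⊆G) (+-cancelʳ-≤ (j * t + 1) _ _ (begin
      ∣ G ∣ + (j * t + 1)                          ≡⟨ cong (_+ (j * t + 1)) ∣G∣≡ ⟩
      largeSize (suc (suc (suc j))) + largeSize (suc j)  ≡⟨ largeSize-sum j ⟩
      largeSize (suc (suc j)) + largeSize (suc (suc j))  ≡⟨ cong₂ _+_ (proj₂ (proj₂ H-large)) (proj₂ (proj₂ K-large)) ⟨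
      ∣ H ∣ + ∣ K ∣                                 ≡⟨ ∣p∪q∣+∣p∩q∣≡∣p∣+∣q∣ H K ⟨
      ∣ H ∪ K ∣ + ∣ H ∩ K ∣                         ≤⟨ +-monoʳ-≤ _ (ρ≤1+i⇒∣∣≤ (H ∩ K) j ρH∩K≤) ⟩
      ∣ H ∪ K ∣ + (j * t + 1)                      ∎))
    where
    open ≤-Reasoning
    ρH∩K≤ : ρ (H ∩ K) ≤ suc j
    ρH∩K≤ = ρ-∩-of-⊈ (proj₁ H-large) (proj₁ (proj₂ H-large)) (proj₁ (proj₂ K-large)) (distinct-large⇒⊈ H-large K-large H≢K)

  -- Double counting of pairs (x, H) with x ∈ G ∖ H: each large hyperplane H of G misses exactly t elements of G,
  -- and by large-hyperplanes-cover each element of G is missed by at most one of them.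
  #largeIn≤ : ∀ j G → ∣ G ∣ ≡ largeSize (suc (suc (suc j))) → #largeIn G (suc (suc j)) ≤ suc (suc j)
  #largeIn≤ j G ∣G∣≡ = t*N≤mt+1⇒N≤m _ (suc (suc j)) t 2≤t (begin
      t * #largeIn G m
    ≡⟨ Σˢ-*ˡ {n} t _ ⟨
      Σˢ (λ H → t * χ (largeIn? G m H))
    ≡⟨ Σˢ-cong misses-t ⟩
      Σˢ (λ H → Σᶠ (λ x → χ (largeIn? G m H) * χ (x ∈? G ∖ H)))
    ≡⟨ Σˢ-Σᶠ-comm {n} {n} _ ⟩
      Σᶠ (λ x → Σˢ (λ H → χ (largeIn? G m H) * χ (x ∈? G ∖ H)))
    ≤⟨ Σᶠ-mono missed-at-most-once ⟩
      Σᶠ (λ x → χ (x ∈? G))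
    ≡⟨ ∣p∣≡Σχ∈ G ⟨
      ∣ G ∣
    ≡⟨ ∣G∣≡ ⟩
      suc (suc j) * t + 1 ∎)
    where
    open ≤-Reasoning
    m = suc (suc j)
    misses-t : ∀ H → t * χ (largeIn? G m H) ≡ Σᶠ (λ x → χ (largeIn? G m H) * χ (x ∈? G ∖ H))
    misses-t H = by-cases (largeIn? G m H)
      where
      by-cases : (d : Dec (LargeIn G m H)) → t * χ d ≡ Σᶠ (λ x → χ d * χ (x ∈? G ∖ H))
      by-cases (no _) = trans (*-zeroʳ t) (sym (Σᶠ-zero {n} _ (λ x → refl)))
      by-cases (yes (H⊆G , _ , _ , ∣H∣≡)) = trans (*-identityʳ t) (sym (trans (Σᶠ-cong {n} (λ x → +-identityʳ (χ (x ∈? G ∖ H))))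
            (largeSize-gap j _ (trans (sym ∣G∣≡) (trans (∣q∣≡∣p∣+Σχ∈∖ H⊆G) (cong (_+ Σᶠ (λ x → χ (x ∈? G ∖ H))) ∣H∣≡))))))
    missed-at-most-once : ∀ x → Σˢ (λ H → χ (largeIn? G m H) * χ (x ∈? G ∖ H)) ≤ χ (x ∈? G)
    missed-at-most-once x = by-cases (x ∈? G)
      where
      by-cases : (d : Dec (x ∈ G)) → Σˢ (λ H → χ (largeIn? G m H) * χ (x ∈? G ∖ H)) ≤ χ d
      by-cases (no x∉G) = ≤-reflexive (Σˢ-zero _ (λ H → ≯0⇒≡0 (λ h → x∉G (proj₁ (proj₂ (χ*χ>0⇒ (largeIn? G m H) (x ∈? G ∖ H) h))))))
      by-cases (yes x∈G) = Σˢ≤1 _ (λ H → χ*χ≤1 (largeIn? G m H) (x ∈? G ∖ H)) unique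
        where
        unique : ∀ H K → 0 < χ (largeIn? G m H) * χ (x ∈? G ∖ H) → 0 < χ (largeIn? G m K) * χ (x ∈? G ∖ K) → H ≡ K
        unique H K h h′ with H ≟ˢ K
        ... | yes H≡K = H≡K
        ... | no H≢K =
          let (H-in , _ , x∉H) = χ*χ>0⇒ (largeIn? G m H) (x ∈? G ∖ H) h
              (K-in , _ , x∉K) = χ*χ>0⇒ (largeIn? G m K) (x ∈? G ∖ K) h′
          in ⊥-elim ([ x∉H , x∉K ]′ (x∈p∪q⁻ H K (subst (x ∈_) (sym (large-hyperplanes-cover j G H K ∣G∣≡ H-in K-in H≢K)) x∈G)))

  flagBound : ℕ → ℕ
  flagBound zero                = 1
  flagBound (suc zero)          = 1
  flagBound (suc (suc zero))    = t + 1
  flagBound (suc (suc (suc k))) = suc (suc k) * flagBound (suc (suc k))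

  flagBound>0 : ∀ k → 1 ≤ flagBound k
  flagBound>0 zero                = ≤-refl
  flagBound>0 (suc zero)          = ≤-refl
  flagBound>0 (suc (suc zero))    = m≤n+m 1 t
  flagBound>0 (suc (suc (suc k))) = *-mono-≤ {1} {suc (suc k)} (s≤s z≤n) (flagBound>0 (suc (suc k)))

  flagBound≡ : ∀ k → flagBound (suc (suc k)) ≡ suc k ! * (t + 1)
  flagBound≡ zero    = sym (+-identityʳ (t + 1))
  flagBound≡ (suc k) = trans (cong (suc (suc k) *_) (flagBound≡ k)) (sym (*-assoc (suc (suc k)) (suc k !) (t + 1)))

  IsLarge0⇒≡⊥ : ∀ K → IsLarge 0 K → K ≡ ⊥
  IsLarge0⇒≡⊥ K (_ , _ , ∣K∣≡0) = Empty-unique (λ { (x , x∈K) → ∣p∣≡0⇒∉ K ∣K∣≡0 x x∈K })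

  ⊥-large : IsLarge 0 ⊥
  ⊥-large = ⊥-flat , ρ⊥≡0 , ∣⊥∣≡0 n

  ⁅x⁆-large : ∀ x → IsLarge 1 ⁅ x ⁆
  ⁅x⁆-large x = ⁅x⁆-flat x , ρ⁅x⁆≡1 x , ∣⁅x⁆∣≡1 x

  IsLarge1⇒≡⁅x⁆ : ∀ H → IsLarge 1 H → ∃ λ x → H ≡ ⁅ x ⁆
  IsLarge1⇒≡⁅x⁆ H (_ , _ , ∣H∣≡1) =
    let (x , x∈H) = ∣p∣>0⇒Nonempty H ∣H∣≡1 in
    x , sym (p⊆q∧∣q∣≤∣p∣⇒p≡q (λ {y} y∈ → subst (_∈ H) (sym (x∈⁅y⁆⇒x≡y x y∈)) x∈H)
                             (≤-trans (≤-reflexive ∣H∣≡1) (≤-reflexive (sym (∣⁅x⁆∣≡1 x)))))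

  #flagsTo1-⁅x⁆ : ∀ x → #flagsTo 1 ⁅ x ⁆ ≡ 1
  #flagsTo1-⁅x⁆ x = cong₂ _*_ (χ-yes (large? 1 ⁅ x ⁆) (⁅x⁆-large x)) only-⊥
    where
    only-⊥ : Σˢ (λ K → χ (K ⊂? ⁅ x ⁆) * #flagsTo 0 K) ≡ 1
    only-⊥ = trans (Σˢ-single _ ⊥ (λ K K≢⊥ → trans (cong (χ (K ⊂? ⁅ x ⁆) *_) (χ-no (large? 0 K) (λ l → K≢⊥ (IsLarge0⇒≡⊥ K l))))
                                                       (*-zeroʳ (χ (K ⊂? ⁅ x ⁆)))))
                   (cong₂ _*_ (χ-yes (⊥ ⊂? ⁅ x ⁆) (⊥⊆ , x , x∈⁅x⁆ x , ∉⊥)) (χ-yes (large? 0 ⊥) ⊥-large))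

  #flagsTo1-as-points : ∀ G → 2 ≤ ∣ G ∣ → ∀ H → χ (H ⊂? G) * #flagsTo 1 H ≡ Σᶠ (λ x → χ (x ∈? G) * χ (H ≟ˢ ⁅ x ⁆))
  #flagsTo1-as-points G 2≤∣G∣ H with any? (λ x → H ≟ˢ ⁅ x ⁆)
  ... | yes (x , refl) = trans (cong₂ _*_ (χ-cong (⁅ x ⁆ ⊂? G) (x ∈? G) (λ s → proj₁ s (x∈⁅x⁆ x))
             (λ x∈G → ⊆∧∣∣<⇒⊂ (λ {y} y∈ → subst (_∈ G) (sym (x∈⁅y⁆⇒x≡y x y∈)) x∈G)
                                (≤-trans (≤-reflexive (cong suc (∣⁅x⁆∣≡1 x))) 2≤∣G∣))) (#flagsTo1-⁅x⁆ x))
         (sym (trans (Σᶠ-single _ x (λ y y≢x → trans (cong (χ (y ∈? G) *_) (χ-no (⁅ x ⁆ ≟ˢ ⁅ y ⁆)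
                   (λ e → y≢x (sym (x∈⁅y⁆⇒x≡y y (subst (x ∈_) e (x∈⁅x⁆ x))))))) (*-zeroʳ (χ (y ∈? G)))))
              (cong (χ (x ∈? G) *_) (χ-yes (⁅ x ⁆ ≟ˢ ⁅ x ⁆) refl))))
  ... | no ¬point = trans (cong (χ (H ⊂? G) *_) (cong (_* Σˢ (λ K → χ (K ⊂? H) * #flagsTo 0 K))
                      (χ-no (large? 1 H) (λ l → ¬point (IsLarge1⇒≡⁅x⁆ H l)))))
      (trans (*-zeroʳ (χ (H ⊂? G))) (sym (Σᶠ-zero {n} _ (λ y → trans (cong (χ (y ∈? G) *_)
        (χ-no (H ≟ˢ ⁅ y ⁆) (λ e → ¬point (y , e)))) (*-zeroʳ (χ (y ∈? G)))))))

  #flagsTo2 : ∀ G → #flagsTo 2 G ≡ χ (large? 2 G) * (t + 1)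
  #flagsTo2 G = χ*-cong (large? 2 G) count-points
    where
    count-points : IsLarge 2 G → Σˢ (λ H → χ (H ⊂? G) * #flagsTo 1 H) ≡ t + 1
    count-points (_ , _ , ∣G∣≡) = begin
        Σˢ (λ H → χ (H ⊂? G) * #flagsTo 1 H)
      ≡⟨ Σˢ-cong (#flagsTo1-as-points G 2≤∣G∣) ⟩
        Σˢ (λ H → Σᶠ (λ x → χ (x ∈? G) * χ (H ≟ˢ ⁅ x ⁆)))
      ≡⟨ Σˢ-Σᶠ-comm {n} {n} _ ⟩
        Σᶠ (λ x → Σˢ (λ H → χ (x ∈? G) * χ (H ≟ˢ ⁅ x ⁆)))
      ≡⟨ Σᶠ-cong (λ x → trans (Σˢ-*ˡ {n} (χ (x ∈? G)) _) (trans (cong (χ (x ∈? G) *_) (Σˢχ≡ ⁅ x ⁆)) (*-identityʳ _))) ⟩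
        Σᶠ (λ x → χ (x ∈? G))
      ≡⟨ ∣p∣≡Σχ∈ G ⟨
        ∣ G ∣
      ≡⟨ ∣G∣≡t+1 ⟩
        t + 1 ∎
      where
      open ≡-Reasoning
      ∣G∣≡t+1 : ∣ G ∣ ≡ t + 1
      ∣G∣≡t+1 = trans ∣G∣≡ (cong (_+ 1) (*-identityˡ t))
      2≤∣G∣ : 2 ≤ ∣ G ∣
      2≤∣G∣ = ≤-trans (+-monoˡ-≤ 1 1≤t) (≤-reflexive (sym ∣G∣≡t+1))

  Σχ-largeIn*≡ : ∀ G m c → Σˢ (λ H → χ (largeIn? G m H) * c) ≡ #largeIn G m * c
  Σχ-largeIn*≡ G m c = trans (Σˢ-cong (λ H → *-comm (χ (largeIn? G m H)) c)) (trans (Σˢ-*ˡ {n} c _) (*-comm c _))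

  Σ-below-large≤ : ∀ j G → (∀ H → #flagsTo (suc (suc j)) H ≤ χ (large? (suc (suc j)) H) * flagBound (suc (suc j))) →
    IsLarge (suc (suc (suc j))) G → Σˢ (λ H → χ (H ⊂? G) * #flagsTo (suc (suc j)) H) ≤ suc (suc j) * flagBound (suc (suc j))
  Σ-below-large≤ j G ih (_ , _ , ∣G∣≡) = begin
      Σˢ (λ H → χ (H ⊂? G) * #flagsTo m H)
    ≤⟨ Σˢ-mono (λ H → ≤-trans (*-monoʳ-≤ (χ (H ⊂? G)) (ih H))
         (≤-trans (≤-reflexive (sym (*-assoc (χ (H ⊂? G)) _ (flagBound m))))
           (*-monoˡ-≤ (flagBound m) (χ*χ≤χ (H ⊂? G) (large? m H) (largeIn? G m H) (λ s l → p⊂q⇒p⊆q s , l))))) ⟩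
      Σˢ (λ H → χ (largeIn? G m H) * flagBound m)
    ≡⟨ Σχ-largeIn*≡ G m (flagBound m) ⟩
      #largeIn G m * flagBound m
    ≤⟨ *-monoˡ-≤ (flagBound m) (#largeIn≤ j G ∣G∣≡) ⟩
      m * flagBound m ∎
    where
    open ≤-Reasoning
    m = suc (suc j)

  #flagsTo≤χ*flagBound : ∀ k G → #flagsTo k G ≤ χ (large? k G) * flagBound k
  #flagsTo≤χ*flagBound zero G = ≤-reflexive (sym (*-identityʳ _))
  #flagsTo≤χ*flagBound (suc zero) G = *-monoʳ-≤ (χ (large? 1 G)) (Σˢ≤1 _ (λ H → χ*χ≤1 (H ⊂? G) (large? 0 H))
      (λ H K h h′ → trans (IsLarge0⇒≡⊥ H (proj₂ (χ*χ>0⇒ (H ⊂? G) (large? 0 H) h)))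
                          (sym (IsLarge0⇒≡⊥ K (proj₂ (χ*χ>0⇒ (K ⊂? G) (large? 0 K) h′))))))
  #flagsTo≤χ*flagBound (suc (suc zero)) G = ≤-reflexive (#flagsTo2 G)
  #flagsTo≤χ*flagBound (suc (suc (suc j))) G =
    χ*-mono (large? (suc (suc (suc j))) G) (Σ-below-large≤ j G (#flagsTo≤χ*flagBound (suc (suc j))))

  #flagsTo-nonlarge : ∀ k H → ¬ IsLarge k H → #flagsTo k H ≡ 0
  #flagsTo-nonlarge k H ¬large =
    n≤0⇒n≡0 (≤-trans (#flagsTo≤χ*flagBound k H) (≤-reflexive (cong (_* flagBound k) (χ-no (large? k H) ¬large))))

  #flagsTo≤flagBound : ∀ k H → #flagsTo k H ≤ flagBound k
  #flagsTo≤flagBound k H = ≤-trans (#flagsTo≤χ*flagBound k H)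
    (≤-trans (*-monoˡ-≤ (flagBound k) (χ≤1 (large? k H))) (≤-reflexive (*-identityˡ (flagBound k))))

  -- Large flats of the next lower rank below G are proper subsets of G simply because they are smaller.
  #flagsTo-via-largeIn : ∀ k G → IsLarge (suc (suc k)) G →
    #flagsTo (suc (suc k)) G ≡ Σˢ (λ H → χ (largeIn? G (suc k) H) * #flagsTo (suc k) H)
  #flagsTo-via-largeIn k G G-large@(_ , _ , ∣G∣≡) =
    trans (cong₂ _*_ (χ-yes (large? (suc (suc k)) G) G-large) (Σˢ-cong term)) (*-identityˡ _)
    where
    term : ∀ H → χ (H ⊂? G) * #flagsTo (suc k) H ≡ χ (largeIn? G (suc k) H) * #flagsTo (suc k) H
    term H = by-cases (large? (suc k) H)
      where
      by-cases : Dec (IsLarge (suc k) H) → χ (H ⊂? G) * #flagsTo (suc k) H ≡ χ (largeIn? G (suc k) H) * #flagsTo (suc k) H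
      by-cases (no ¬large) = trans (cong (χ (H ⊂? G) *_) (#flagsTo-nonlarge (suc k) H ¬large))
        (trans (*-zeroʳ (χ (H ⊂? G))) (sym (trans (cong (χ (largeIn? G (suc k) H) *_) (#flagsTo-nonlarge (suc k) H ¬large))
                                                  (*-zeroʳ (χ (largeIn? G (suc k) H))))))
      by-cases (yes H-large@(_ , _ , ∣H∣≡)) = cong (_* #flagsTo (suc k) H)
        (χ-cong (H ⊂? G) (largeIn? G (suc k) H) (λ s → p⊂q⇒p⊆q s , H-large)
          (λ { (s , _) → ⊆∧∣∣<⇒⊂ s (subst₂ _<_ (sym ∣H∣≡) (sym ∣G∣≡) (largeSize-< k)) }))

  #flagsTo≡flagBound⇒#largeIn≡ : ∀ j G → IsLarge (suc (suc (suc j))) G →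
    #flagsTo (suc (suc (suc j))) G ≡ flagBound (suc (suc (suc j))) → #largeIn G (suc (suc j)) ≡ suc (suc j)
  #flagsTo≡flagBound⇒#largeIn≡ j G G-large@(_ , _ , ∣G∣≡) #flagsTo≡ =
    ≤-antisym (#largeIn≤ j G ∣G∣≡) (≮⇒≥ λ #largeIn<m → <⇒≱ (begin-strict
      #flagsTo (suc m) G                              ≡⟨ #flagsTo-via-largeIn (suc j) G G-large ⟩
      Σˢ (λ H → χ (largeIn? G m H) * #flagsTo m H)    ≤⟨ Σˢ-mono (λ H → *-monoʳ-≤ (χ (largeIn? G m H)) (#flagsTo≤flagBound m H)) ⟩
      Σˢ (λ H → χ (largeIn? G m H) * flagBound m)     ≡⟨ Σχ-largeIn*≡ G m (flagBound m) ⟩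
      #largeIn G m * flagBound m                      <⟨ *-monoˡ-< (flagBound m) ⦃ >-nonZero (flagBound>0 m) ⦄ #largeIn<m ⟩
      m * flagBound m                                 ∎) (≤-reflexive (sym #flagsTo≡)))
    where
    open ≤-Reasoning
    m = suc (suc j)

  module _ (j : ℕ) {G H : Subset n} (G-large : IsLarge (suc (suc (suc (suc j)))) G)
           (H-in : LargeIn G (suc (suc (suc j))) H) where

    private
      m = suc (suc (suc j))
      H⊆G = proj₁ H-in
      H-large = proj₂ H-in
      ∣G∣≡ = proj₂ (proj₂ G-large)

    OtherHyperplane : Subset n → Set
    OtherHyperplane K = LargeIn G m K × K ≢ H

    otherHyperplane? : ∀ K → Dec (OtherHyperplane K)
    otherHyperplane? K = largeIn? G m K ×-dec ¬? (K ≟ˢ H)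

    H∪K≡G : ∀ {K} → OtherHyperplane K → H ∪ K ≡ G
    H∪K≡G {K} (K-in , K≢H) = large-hyperplanes-cover (suc j) G H K ∣G∣≡ H-in K-in (λ e → K≢H (sym e))

    H∩K-large : ∀ K → OtherHyperplane K → LargeIn H (suc (suc j)) (H ∩ K)
    H∩K-large K other@((K⊆G , K-large) , K≢H) =
      p∩q⊆p H K , ∩-flat H K (proj₁ H-large) (proj₁ K-large) , ρH∩K≡ , ∣H∩K∣≡
      where
      ∣H∩K∣≡ : ∣ H ∩ K ∣ ≡ largeSize (suc (suc j))
      ∣H∩K∣≡ = +-cancelˡ-≡ (largeSize (suc m)) _ _ (begin
          largeSize (suc m) + ∣ H ∩ K ∣     ≡⟨ cong (_+ ∣ H ∩ K ∣) (trans (cong ∣_∣ (H∪K≡G other)) ∣G∣≡) ⟨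
          ∣ H ∪ K ∣ + ∣ H ∩ K ∣             ≡⟨ ∣p∪q∣+∣p∩q∣≡∣p∣+∣q∣ H K ⟩
          ∣ H ∣ + ∣ K ∣                     ≡⟨ cong₂ _+_ (proj₂ (proj₂ H-large)) (proj₂ (proj₂ K-large)) ⟩
          largeSize m + largeSize m         ≡⟨ largeSize-sum (suc j) ⟨
          largeSize (suc m) + largeSize (suc (suc j)) ∎)
        where open ≡-Reasoning
      ρH∩K≡ : ρ (H ∩ K) ≡ suc (suc j)
      ρH∩K≡ = ≤-antisym
        (ρ-∩-of-⊈ (proj₁ H-large) (proj₁ (proj₂ H-large)) (proj₁ (proj₂ K-large))
                  (distinct-large⇒⊈ H-large K-large (λ e → K≢H (sym e))))
        (∣∣≡kt+1⇒ρ>k (H ∩ K) (suc j) ∣H∩K∣≡)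

    H∩-injective : ∀ K K′ → OtherHyperplane K → OtherHyperplane K′ → H ∩ K ≡ H ∩ K′ → K ≡ K′
    H∩-injective K K′ other other′ e = ⊆-antisym (K⊆K′ other other′ e) (K⊆K′ other′ other (sym e))
      where
      K⊆K′ : ∀ {K K′} → OtherHyperplane K → OtherHyperplane K′ → H ∩ K ≡ H ∩ K′ → K ⊆ K′
      K⊆K′ {K} {K′} ((K⊆G , _) , _) other′ e {x} x∈K with x ∈? H
      ... | yes x∈H = proj₂ (x∈p∩q⁻ H K′ (subst (x ∈_) e (x∈p∩q⁺ (x∈H , x∈K))))
      ... | no x∉H  = [ (λ x∈H → ⊥-elim (x∉H x∈H)) , (λ x∈K′ → x∈K′) ]′
                        (x∈p∪q⁻ H K′ (subst (x ∈_) (sym (H∪K≡G other′)) (K⊆G x∈K)))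

    -- Every other large hyperplane K of G meets H in a large hyperplane of H, and K is recovered from H ∩ K.
    #largeIn≤1+#largeIn-hyperplane : #largeIn G m ≤ suc (#largeIn H (suc (suc j)))
    #largeIn≤1+#largeIn-hyperplane = begin
        #largeIn G m
      ≤⟨ Σˢ-mono split ⟩
        Σˢ (λ K → χ (K ≟ˢ H) + χ (otherHyperplane? K))
      ≡⟨ Σˢ-distrib-+ (λ K → χ (K ≟ˢ H)) (λ K → χ (otherHyperplane? K)) ⟩
        Σˢ (λ K → χ (K ≟ˢ H)) + count otherHyperplane?
      ≡⟨ cong (_+ count otherHyperplane?) (Σˢχ≡ H) ⟩
        suc (count otherHyperplane?)
      ≤⟨ s≤s (count-≤-injection otherHyperplane? (largeIn? H (suc (suc j))) (H ∩_) H∩K-large H∩-injective) ⟩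
        suc (#largeIn H (suc (suc j))) ∎
      where
      open ≤-Reasoning
      split : ∀ K → χ (largeIn? G m K) ≤ χ (K ≟ˢ H) + χ (otherHyperplane? K)
      split K = by-cases (K ≟ˢ H)
        where
        by-cases : Dec (K ≡ H) → χ (largeIn? G m K) ≤ χ (K ≟ˢ H) + χ (otherHyperplane? K)
        by-cases (yes K≡H) = ≤-trans (χ≤1 (largeIn? G m K)) (≤-trans (≤-reflexive (sym (χ-yes (K ≟ˢ H) K≡H))) (m≤m+n _ _))
        by-cases (no K≢H)  = ≤-trans (χ-mono (largeIn? G m K) (otherHyperplane? K) (λ l → l , K≢H)) (m≤n+m _ _)

    #largeIn-hyperplane-max : #largeIn G m ≡ m → #largeIn H (suc (suc j)) ≡ suc (suc j)
    #largeIn-hyperplane-max #largeIn≡m = ≤-antisym (#largeIn≤ j H (proj₂ (proj₂ H-large)))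
      (≤-pred (≤-trans (≤-reflexive (sym #largeIn≡m)) #largeIn≤1+#largeIn-hyperplane))

  #largeIn≡⇒#flagsTo≡flagBound : ∀ j G → IsLarge (suc (suc (suc j))) G →
    #largeIn G (suc (suc j)) ≡ suc (suc j) → #flagsTo (suc (suc (suc j))) G ≡ flagBound (suc (suc (suc j)))
  #largeIn≡⇒#flagsTo≡flagBound j G G-large #largeIn≡m = begin
      #flagsTo (suc m) G                            ≡⟨ #flagsTo-via-largeIn (suc j) G G-large ⟩
      Σˢ (λ H → χ (largeIn? G m H) * #flagsTo m H)  ≡⟨ Σˢ-cong (λ H → χ*-cong (largeIn? G m H) (hyperplane-max j H G-large #largeIn≡m)) ⟩
      Σˢ (λ H → χ (largeIn? G m H) * flagBound m)   ≡⟨ Σχ-largeIn*≡ G m (flagBound m) ⟩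
      #largeIn G m * flagBound m                    ≡⟨ cong (_* flagBound m) #largeIn≡m ⟩
      m * flagBound m                               ∎
    where
    open ≡-Reasoning
    m = suc (suc j)
    hyperplane-max : ∀ j′ {G′} H → IsLarge (suc (suc (suc j′))) G′ → #largeIn G′ (suc (suc j′)) ≡ suc (suc j′) →
      LargeIn G′ (suc (suc j′)) H → #flagsTo (suc (suc j′)) H ≡ flagBound (suc (suc j′))
    hyperplane-max zero H _ _ (_ , H-large) =
      trans (#flagsTo2 H) (trans (cong (_* (t + 1)) (χ-yes (large? 2 H) H-large)) (*-identityˡ _))
    hyperplane-max (suc j′) H G′-large #largeIn≡ H-in =
      #largeIn≡⇒#flagsTo≡flagBound j′ H (proj₂ H-in) (#largeIn-hyperplane-max j′ G′-large H-in #largeIn≡)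

-- Spikes

module SpikeCharacterisation {n : ℕ} (M : Matroid n) (r′ t : ℕ) (2≤t : 2 ≤ t)
  (ρ⊤≡r : rk M ⊤ ≡ suc (suc (suc r′))) (bound : FlatSizeBound M (suc (suc (suc r′))) t)
  (n≡ : n ≡ suc (suc r′) * t + 1) where

  r = suc (suc (suc r′))
  q = suc (suc r′)

  open LargeFlags M r t (s≤s (s≤s z≤n)) 2≤t ρ⊤≡r bound public

  ∣⊤∣≡ : ∣ ⊤ {n} ∣ ≡ largeSize (suc q)
  ∣⊤∣≡ = trans (∣⊤∣≡n n) n≡

  ∣∁⁅j⁆∣≡ : ∀ (j : Fin q) → ∣ ∁ ⁅ j ⁆ ∣ ≡ suc r′
  ∣∁⁅j⁆∣≡ j = trans (∣∁p∣≡n∸∣p∣ ⁅ j ⁆) (cong (q ∸_) (∣⁅x⁆∣≡1 j))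

  largeSize≤∣X∣⇒closed : ∀ i X → 1 ≤ i → i ≤ r → ρ X ≡ i → largeSize i ≤ ∣ X ∣ → X ≡ cl X × ∣ X ∣ ≡ largeSize i
  largeSize≤∣X∣⇒closed (suc i) X 1≤i i≤r ρX≡ ∣X∣≥ = X≡clX , ≤-antisym (subst (λ Y → ∣ Y ∣ ≤ largeSize (suc i)) (sym X≡clX) ∣clX∣≤) ∣X∣≥
    where
    ∣clX∣≤ : ∣ cl X ∣ ≤ largeSize (suc i)
    ∣clX∣≤ = bound (suc i) (cl X) 1≤i i≤r (cl-flat X) (trans (ρ-cl X) ρX≡)
    X≡clX : X ≡ cl X
    X≡clX = p⊆q∧∣q∣≤∣p∣⇒p≡q (X⊆clX X) (≤-trans ∣clX∣≤ ∣X∣≥)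

  module FromSpike (a : Fin n) (L : Fin q → Subset n)
    (lines : ∀ i → IsFlat M (L i) × rk M (L i) ≡ 2 × ∣ L i ∣ ≡ t + 1 × a ∈ L i)
    (covering : bigUnion L ⊤ ≡ ⊤) (ρ-bigUnion : ∀ (K : Subset q) → 1 ≤ ∣ K ∣ → rk M (bigUnion L K) ≡ ∣ K ∣ + 1) where

    hyperplane : Fin q → Subset n
    hyperplane j = bigUnion L (∁ ⁅ j ⁆)

    ρ-hyperplane : ∀ j → ρ (hyperplane j) ≡ q
    ρ-hyperplane j = trans (ρ-bigUnion (∁ ⁅ j ⁆) (≤-trans (s≤s z≤n) (≤-reflexive (sym (∣∁⁅j⁆∣≡ j)))))
                           (trans (cong (_+ 1) (∣∁⁅j⁆∣≡ j)) (+-comm (suc r′) 1))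

    a∈hyperplane : ∀ j → a ∈ hyperplane j
    a∈hyperplane j = let (i , i∈) = ∣p∣>0⇒Nonempty (∁ ⁅ j ⁆) (∣∁⁅j⁆∣≡ j) in
      ∈bigUnion⁺ L (∁ ⁅ j ⁆) i i∈ (proj₂ (proj₂ (proj₂ (lines i))))

    ∉hyperplane⇒∈line : ∀ j x → x ∉ hyperplane j → x ∈ L j
    ∉hyperplane⇒∈line j x x∉ with ∈bigUnion⁻ L ⊤ (subst (x ∈_) (sym covering) ∈⊤)
    ... | (i , _ , x∈Li) with i ≟ᶠ j
    ...   | yes refl = x∈Li
    ...   | no i≢j   = ⊥-elim (x∉ (∈bigUnion⁺ L (∁ ⁅ j ⁆) i (≢⇒∈∁⁅⁆ i≢j) x∈Li))

    ∣∁hyperplane∣≤t : ∀ j → ∣ ∁ (hyperplane j) ∣ ≤ t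
    ∣∁hyperplane∣≤t j = ≤-pred (begin
        suc ∣ ∁ (hyperplane j) ∣       ≡⟨ ∣p∪⁅x⁆∣≡1+∣p∣ (∁ (hyperplane j)) a (x∈p⇒x∉∁p (a∈hyperplane j)) ⟨
        ∣ ∁ (hyperplane j) ∪ ⁅ a ⁆ ∣   ≤⟨ p⊆q⇒∣p∣≤∣q∣ (∪-least (λ {x} h → ∉hyperplane⇒∈line j x (x∈∁p⇒x∉p h))
                                         (λ {x} h → subst (_∈ L j) (sym (x∈⁅y⁆⇒x≡y a h)) (proj₂ (proj₂ (proj₂ (lines j)))))) ⟩
        ∣ L j ∣                        ≡⟨ proj₁ (proj₂ (proj₂ (lines j))) ⟩
        t + 1                          ≡⟨ +-comm t 1 ⟩
        suc t                          ∎)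
      where open ≤-Reasoning

    largeSize≤∣hyperplane∣ : ∀ j → largeSize q ≤ ∣ hyperplane j ∣
    largeSize≤∣hyperplane∣ j = +-cancelˡ-≤ t _ _ (begin
        t + (suc r′ * t + 1)                  ≡⟨ +-assoc t (suc r′ * t) 1 ⟨
        q * t + 1                             ≡⟨ n≡ ⟨
        n                                     ≤⟨ m≤n+m∸n n ∣ hyperplane j ∣ ⟩
        ∣ hyperplane j ∣ + (n ∸ ∣ hyperplane j ∣) ≤⟨ +-monoʳ-≤ ∣ hyperplane j ∣
                                                   (≤-trans (≤-reflexive (sym (∣∁p∣≡n∸∣p∣ (hyperplane j)))) (∣∁hyperplane∣≤t j)) ⟩
        ∣ hyperplane j ∣ + t                  ≡⟨ +-comm ∣ hyperplane j ∣ t ⟩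
        t + ∣ hyperplane j ∣                  ∎)
      where open ≤-Reasoning

    hyperplane-large : ∀ j → LargeIn ⊤ q (hyperplane j)
    hyperplane-large j =
      let (≡cl , ∣∣≡) = largeSize≤∣X∣⇒closed q (hyperplane j) (s≤s z≤n) (n≤1+n q) (ρ-hyperplane j) (largeSize≤∣hyperplane∣ j) in
      ⊆⊤ , subst (IsFlat M) (sym ≡cl) (cl-flat (hyperplane j)) , ρ-hyperplane j , ∣∣≡

    hyperplane-injective : ∀ i j → hyperplane i ≡ hyperplane j → i ≡ j
    hyperplane-injective i j e with i ≟ᶠ j
    ... | yes i≡j = i≡j
    ... | no i≢j  = ⊥-elim (x∉Hj (subst (x ∈_) e (∈bigUnion⁺ L (∁ ⁅ i ⁆) j (≢⇒∈∁⁅⁆ (λ e′ → i≢j (sym e′))) (∉hyperplane⇒∈line j x x∉Hj))))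
      where
      ⊤⊈Hj : ¬ (⊤ ⊆ hyperplane j)
      ⊤⊈Hj ⊤⊆ = <⇒≱ (subst₂ _<_ (sym (proj₂ (proj₂ (proj₂ (hyperplane-large j))))) (sym ∣⊤∣≡) (largeSize-< (suc r′)))
                    (p⊆q⇒∣p∣≤∣q∣ ⊤⊆)
      x = proj₁ (⊈⇒∃ ⊤ (hyperplane j) ⊤⊈Hj)
      x∉Hj = proj₂ (proj₂ (⊈⇒∃ ⊤ (hyperplane j) ⊤⊈Hj))

  spike⇒#largeIn≡ : IsSpike M r t → #largeIn ⊤ q ≡ q
  spike⇒#largeIn≡ (_ , _ , a , L , lines , covering , ρ-bigUnion) =
    ≤-antisym (#largeIn≤ r′ ⊤ ∣⊤∣≡) (≤count-injection (largeIn? ⊤ q) hyperplane hyperplane-large hyperplane-injective)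
    where open FromSpike a L lines covering ρ-bigUnion

  -- Each large hyperplane misses exactly t elements and no element is missed twice; as n = qt + 1,
  -- exactly one element a lies on all of them, and the lines of the spike are the complements with a added.
  module FromHyperplanes (f : Fin q → Subset n) (f-large : ∀ i → LargeIn ⊤ q (f i))
    (f-injective : ∀ i j → f i ≡ f j → i ≡ j) where

    ∉one⇒∈other : ∀ i j → i ≢ j → ∀ x → x ∉ f i → x ∈ f j
    ∉one⇒∈other i j i≢j x x∉fi = [ (λ x∈fi → ⊥-elim (x∉fi x∈fi)) , (λ x∈fj → x∈fj) ]′
      (x∈p∪q⁻ (f i) (f j) (subst (x ∈_) (sym (large-hyperplanes-cover r′ ⊤ (f i) (f j) ∣⊤∣≡ (f-large i) (f-large j)
                                                 (λ e → i≢j (f-injective i j e)))) ∈⊤))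

    #missing : Fin n → ℕ
    #missing x = Σᶠ (λ i → χ (¬? (x ∈? f i)))

    #missing≤1 : ∀ x → #missing x ≤ 1
    #missing≤1 x = Σᶠ≤1 _ (λ i → χ≤1 (¬? (x ∈? f i))) unique
      where
      unique : ∀ i j → 0 < χ (¬? (x ∈? f i)) → 0 < χ (¬? (x ∈? f j)) → i ≡ j
      unique i j h h′ with i ≟ᶠ j
      ... | yes i≡j = i≡j
      ... | no i≢j  = ⊥-elim (χ>0⇒ (¬? (x ∈? f j)) h′ (∉one⇒∈other i j i≢j x (χ>0⇒ (¬? (x ∈? f i)) h)))

    ∣∁f∣≡t : ∀ i → ∣ ∁ (f i) ∣ ≡ t
    ∣∁f∣≡t i = trans (∣∁p∣≡n∸∣p∣ (f i))
      (trans (cong₂ _∸_ (trans n≡ (identity r′ t)) (proj₂ (proj₂ (proj₂ (f-large i))))) (m+n∸n≡m t (suc r′ * t + 1)))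
      where
      identity : ∀ r′ t → suc (suc r′) * t + 1 ≡ t + (suc r′ * t + 1)
      identity = solve-∀

    Σ#missing≡ : Σᶠ #missing ≡ q * t
    Σ#missing≡ = begin
        Σᶠ #missing                              ≡⟨ Σᶠ-comm {n} {q} (λ x i → χ (¬? (x ∈? f i))) ⟩
        Σᶠ (λ i → Σᶠ (λ x → χ (¬? (x ∈? f i))))  ≡⟨ Σᶠ-cong (λ i → trans (Σᶠ-cong (λ x →
                                                      χ-cong (¬? (x ∈? f i)) (x ∈? ∁ (f i)) x∉p⇒x∈∁p x∈∁p⇒x∉p))
                                                      (trans (sym (∣p∣≡Σχ∈ (∁ (f i)))) (∣∁f∣≡t i))) ⟩
        Σᶠ {q} (λ _ → t)                         ≡⟨ Σᶠ-const {q} t ⟩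
        q * t                                    ∎
      where open ≡-Reasoning

    Σ1≡ : Σᶠ {n} (λ _ → 1) ≡ q * t + 1
    Σ1≡ = trans (Σᶠ-const {n} 1) (trans (*-identityʳ n) n≡)

    ∃-tip : ∃ λ x → #missing x ≡ 0
    ∃-tip with any? (λ x → #missing x ≟ 0)
    ... | yes w = w
    ... | no ¬w = ⊥-elim (1+n≰n (begin
        suc (q * t)         ≡⟨ +-comm 1 (q * t) ⟩
        q * t + 1           ≡⟨ Σ1≡ ⟨
        Σᶠ {n} (λ _ → 1)    ≤⟨ Σᶠ-mono (λ x → n≢0⇒n>0 (λ e → ¬w (x , e))) ⟩
        Σᶠ #missing         ≡⟨ Σ#missing≡ ⟩
        q * t               ∎))
      where open ≤-Reasoning

    a : Fin n
    a = proj₁ ∃-tip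

    #missing≡0⇒∈ : ∀ x → #missing x ≡ 0 → ∀ i → x ∈ f i
    #missing≡0⇒∈ x #missing≡0 i = decidable-stable (x ∈? f i) λ x∉fi →
      1+n≰n (≤-trans (≤-reflexive (sym (χ-yes (¬? (x ∈? f i)) x∉fi)))
                     (≤-trans (Σᶠ-term (λ i → χ (¬? (x ∈? f i))) i) (≤-reflexive #missing≡0)))

    a∈f : ∀ i → a ∈ f i
    a∈f = #missing≡0⇒∈ a (proj₂ ∃-tip)

    -- Two elements on every hyperplane would make Σ (1 - #missing) ≥ 2, but it is n - qt = 1.
    ∈all⇒≡a : ∀ x → (∀ i → x ∈ f i) → x ≡ a
    ∈all⇒≡a x x∈all with x ≟ᶠ a
    ... | yes x≡a = x≡a
    ... | no x≢a  = ⊥-elim (1+n≰n (+-cancelʳ-≤ (q * t) 2 1 (begin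
        2 + q * t               ≡⟨ cong₂ (λ u v → u + v + q * t) (sym (χ-yes (#missing x ≟ 0) #missing-x≡0))
                                                                (sym (χ-yes (#missing a ≟ 0) (proj₂ ∃-tip))) ⟩
        on-all x + on-all a + q * t  ≤⟨ +-monoˡ-≤ (q * t) (Σᶠ-two-terms on-all x a x≢a) ⟩
        Σᶠ on-all + q * t       ≡⟨ cong (Σᶠ on-all +_) Σ#missing≡ ⟨
        Σᶠ on-all + Σᶠ #missing ≡⟨ Σᶠ-distrib-+ on-all #missing ⟨
        Σᶠ (λ y → on-all y + #missing y) ≡⟨ Σᶠ-cong on-all+#missing≡1 ⟩
        Σᶠ {n} (λ _ → 1)        ≡⟨ Σ1≡ ⟩
        q * t + 1               ≡⟨ +-comm (q * t) 1 ⟩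
        1 + q * t               ∎)))
      where
      open ≤-Reasoning
      #missing-x≡0 : #missing x ≡ 0
      #missing-x≡0 = Σᶠ-zero _ (λ i → χ-no (¬? (x ∈? f i)) (λ x∉ → x∉ (x∈all i)))
      on-all : Fin n → ℕ
      on-all y = χ (#missing y ≟ 0)
      on-all+#missing≡1 : ∀ y → on-all y + #missing y ≡ 1
      on-all+#missing≡1 y with #missing y | #missing≤1 y
      ... | zero        | _ = refl
      ... | suc zero    | _ = refl
      ... | suc (suc _) | s≤s ()

    line : Fin q → Subset n
    line i = ∁ (f i) ∪ ⁅ a ⁆

    a∈line : ∀ i → a ∈ line i
    a∈line i = ∈∪ʳ (x∈⁅x⁆ a)

    ∣line∣≡ : ∀ i → ∣ line i ∣ ≡ t + 1
    ∣line∣≡ i = trans (∣p∪⁅x⁆∣≡1+∣p∣ (∁ (f i)) a (x∈p⇒x∉∁p (a∈f i))) (trans (cong suc (∣∁f∣≡t i)) (+-comm 1 t))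

    line⊆bigInter : ∀ i → line i ⊆ bigInter f (∁ ⁅ i ⁆)
    line⊆bigInter i {x} h with x∈p∪q⁻ (∁ (f i)) ⁅ a ⁆ h
    ... | inj₁ x∈∁fi = ∈bigInter⁺ f (∁ ⁅ i ⁆) (λ j j∈ → ∉one⇒∈other i j (λ e → ∈∁⁅⁆⇒≢ j∈ (sym e)) x (x∈∁p⇒x∉p x∈∁fi))
    ... | inj₂ x∈⁅a⁆ = ∈bigInter⁺ f (∁ ⁅ i ⁆) (λ j _ → subst (_∈ f j) (sym (x∈⁅y⁆⇒x≡y a x∈⁅a⁆)) (a∈f j))

    ρ-line≡2 : ∀ i → ρ (line i) ≡ 2
    ρ-line≡2 i = ≤-antisym upper (∣∣≡kt+1⇒ρ>k (line i) 1 ∣line∣≡1t+1)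
      where
      ∣line∣≡1t+1 : ∣ line i ∣ ≡ 1 * t + 1
      ∣line∣≡1t+1 = trans (∣line∣≡ i) (cong (_+ 1) (sym (*-identityˡ t)))
      upper : ρ (line i) ≤ 2
      upper = +-cancelʳ-≤ (suc r′) _ _ (≤-trans (+-monoˡ-≤ (suc r′) (ρ-mono (line⊆bigInter i)))
        (≤-trans (≤-reflexive (cong (ρ (bigInter f (∁ ⁅ i ⁆)) +_) (sym (∣∁⁅j⁆∣≡ i))))
          (ρ-bigInter+∣S∣≤ ρ⊤≡r f (λ j → ≤-reflexive (cong suc (proj₁ (proj₂ (proj₂ (f-large j)))))) ∉one⇒∈other (∁ ⁅ i ⁆))))

    line-flat : ∀ i → IsFlat M (line i)
    line-flat i = subst (IsFlat M) (sym (proj₁ (largeSize≤∣X∣⇒closed 2 (line i) (s≤s z≤n) (s≤s (s≤s z≤n)) (ρ-line≡2 i)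
      (≤-reflexive (trans (cong (_+ 1) (*-identityˡ t)) (sym (∣line∣≡ i))))))) (cl-flat (line i))

    lines-cover : bigUnion line ⊤ ≡ ⊤
    lines-cover = ⊆-antisym ⊆⊤ ⊤⊆
      where
      ⊤⊆ : ⊤ ⊆ bigUnion line ⊤
      ⊤⊆ {x} _ with any? (λ i → ¬? (x ∈? f i))
      ... | yes (i , x∉fi) = ∈bigUnion⁺ line ⊤ i ∈⊤ (∈∪ˡ (x∉p⇒x∈∁p x∉fi))
      ... | no ¬∃ = ∈bigUnion⁺ line ⊤ fzero ∈⊤
        (subst (_∈ line fzero) (sym (∈all⇒≡a x (λ i → decidable-stable (x ∈? f i) (λ x∉ → ¬∃ (i , x∉))))) (a∈line fzero))

    ρ-bigUnion-lines : ∀ (K : Subset q) → 1 ≤ ∣ K ∣ → ρ (bigUnion line K) ≡ ∣ K ∣ + 1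
    ρ-bigUnion-lines K 1≤∣K∣ = ≤-antisym upper lower
      where
      lines≤ = ρ-∪-lines≤ line a (≤-reflexive (sym (ρ⁅x⁆≡1 a))) (λ i → ≤-reflexive (ρ-line≡2 i)) a∈line
      a∈U : a ∈ bigUnion line K
      a∈U = let (i , i∈K) = ∣p∣>0⇒Nonempty K (sym (suc-pred ∣ K ∣ ⦃ >-nonZero 1≤∣K∣ ⦄)) in
        ∈bigUnion⁺ line K i i∈K (a∈line i)
      upper : ρ (bigUnion line K) ≤ ∣ K ∣ + 1
      upper = ≤-trans (ρ-mono (λ h → ∈∪ʳ {p = ⁅ a ⁆} h))
        (≤-trans (lines≤ K ⁅ a ⁆ (x∈⁅x⁆ a)) (≤-reflexive (trans (cong (_+ ∣ K ∣) (ρ⁅x⁆≡1 a)) (+-comm 1 ∣ K ∣))))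
      split : ⊤ ⊆ bigUnion line K ∪ bigUnion line (∁ K)
      split {x} _ with ∈bigUnion⁻ line ⊤ (subst (x ∈_) (sym lines-cover) ∈⊤)
      ... | (j , _ , x∈) with j ∈? K
      ...   | yes j∈K = ∈∪ˡ (∈bigUnion⁺ line K j j∈K x∈)
      ...   | no j∉K  = ∈∪ʳ (∈bigUnion⁺ line (∁ K) j (x∉p⇒x∈∁p j∉K) x∈)
      lower : ∣ K ∣ + 1 ≤ ρ (bigUnion line K)
      lower = ≤-trans (≤-reflexive (+-comm ∣ K ∣ 1)) (+-cancelʳ-≤ (q ∸ ∣ K ∣) _ _ (begin
          suc ∣ K ∣ + (q ∸ ∣ K ∣)                  ≡⟨ cong suc (m+[n∸m]≡n (∣p∣≤n K)) ⟩
          r                                        ≡⟨ ρ⊤≡r ⟨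
          ρ ⊤                                      ≤⟨ ρ-mono split ⟩
          ρ (bigUnion line K ∪ bigUnion line (∁ K)) ≤⟨ lines≤ (∁ K) (bigUnion line K) a∈U ⟩
          ρ (bigUnion line K) + ∣ ∁ K ∣            ≡⟨ cong (ρ (bigUnion line K) +_) (∣∁p∣≡n∸∣p∣ K) ⟩
          ρ (bigUnion line K) + (q ∸ ∣ K ∣)        ∎))
        where open ≤-Reasoning

    spike : IsSpike M r t
    spike = (ρ⁅x⁆≡1 , ρ⁅x,y⁆≡2) , ρ⊤≡r , a , line ,
      (λ i → line-flat i , ρ-line≡2 i , ∣line∣≡ i , a∈line i) , lines-cover , ρ-bigUnion-lines

  #largeIn≡⇒spike : #largeIn ⊤ q ≡ q → IsSpike M r t
  #largeIn≡⇒spike #largeIn≡q =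
    let (f , f-large , f-injective) = count-enumeration (largeIn? ⊤ q) q #largeIn≡q in
    FromHyperplanes.spike f f-large f-injective

module LargeFlagCount {n : ℕ} (M : Matroid n) (r t : ℕ) (2≤r : 2 ≤ r) (2≤t : 2 ≤ t)
  (ρ⊤≡r : rk M ⊤ ≡ r) (bound : FlatSizeBound M r t) where

  open LargeFlags M r t 2≤r 2≤t ρ⊤≡r bound

  module _ (n≡ : n ≡ largeSize r) where

    ⊤-large : IsLarge r ⊤
    ⊤-large = (λ e e∉⊤ → ⊥-elim (e∉⊤ ∈⊤)) , ρ⊤≡r , trans (∣⊤∣≡n n) n≡

    largeFlags≡#flagsTo⊤ : largeFlags M r t ≡ #flagsTo r ⊤
    largeFlags≡#flagsTo⊤ = begin
        largeFlags M r t
      ≡⟨ length-filter≡Σᴸχ (isFlagChain? M r (largeSizes t)) chains ⟩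
        Σᴸ chains (λ v → χ (isFlagChain? M r (largeSizes t) v))
      ≡⟨ Σᴸ-cong chains (λ v → trans (χ-cong (isFlagChain? M r (largeSizes t) v) (isFlagChain? M r (sizes r) v)
           (resize largeSizes≡ v) (resize (λ i → sym (largeSizes≡ i)) v)) (sym (*-identityʳ _))) ⟩
        Σᴸ chains (λ v → χ (isFlagChain? M r (sizes r) v) * 1)
      ≡⟨ Σchains≡Σ#flagsTo r (λ _ → 1) ⟩
        Σˢ (λ G → #flagsTo r G * 1)
      ≡⟨ Σˢ-single _ ⊤ (λ G G≢⊤ → cong (_* 1) (#flagsTo-nonlarge r G
           (λ G-large → G≢⊤ (∣p∣≡n⇒p≡⊤ (trans (proj₂ (proj₂ G-large)) (sym n≡)))))) ⟩
        #flagsTo r ⊤ * 1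
      ≡⟨ *-identityʳ _ ⟩
        #flagsTo r ⊤ ∎
      where
      open ≡-Reasoning
      chains = allVecs (allSubsets n) (suc r)
      largeSizes≡ : ∀ {k} (i : Fin (suc k)) → largeSizes t i ≡ largeSize (toℕ i)
      largeSizes≡ i with toℕ i
      ... | zero  = refl
      ... | suc j = refl
      resize : ∀ {k} {s s′ : Fin (suc k) → ℕ} → (∀ i → s i ≡ s′ i) → ∀ v → IsFlagChain M k s v → IsFlagChain M k s′ v
      resize s≡s′ v (large , ⊂next) =
        (λ i → proj₁ (large i) , proj₁ (proj₂ (large i)) , trans (proj₂ (proj₂ (large i))) (s≡s′ i)) , ⊂next

    largeFlags≤flagBound : largeFlags M r t ≤ flagBound r
    largeFlags≤flagBound = ≤-trans (≤-reflexive largeFlags≡#flagsTo⊤) (#flagsTo≤flagBound r ⊤)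

  largeHyperplanes≡#largeIn⊤ : ∀ k → r ≡ suc (suc k) → largeHyperplanes M r t ≡ #largeIn ⊤ (suc k)
  largeHyperplanes≡#largeIn⊤ k refl = trans (length-filter≡Σᴸχ (isLargeFlat? M t (suc k)) (allSubsets n))
    (trans (Σᴸ-allSubsets≡Σˢ n _) (Σˢ-cong (λ H → χ-cong (isLargeFlat? M t (suc k) H) (largeIn? ⊤ (suc k) H)
      (λ l → ⊆⊤ , l) proj₂)))

module RankTwo {n : ℕ} (M : Matroid n) (t : ℕ) (2≤t : 2 ≤ t) (ρ⊤≡2 : rk M ⊤ ≡ 2)
  (bound : FlatSizeBound M 2 t) (n≡ : n ≡ 1 * t + 1) where

  open LargeFlags M 2 t ≤-refl 2≤t ρ⊤≡2 bound
  open LargeFlagCount M 2 t ≤-refl 2≤t ρ⊤≡2 bound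

  largeFlags≡ : largeFlags M 2 t ≡ 1 ! * (t + 1)
  largeFlags≡ = trans (largeFlags≡#flagsTo⊤ n≡) (trans (#flagsTo2 ⊤) (cong (_* (t + 1)) (χ-yes (large? 2 ⊤) (⊤-large n≡))))

  -- The whole ground set is the only line, and any element serves as the tip.
  spike : IsSpike M 2 t
  spike = (ρ⁅x⁆≡1 , ρ⁅x,y⁆≡2) , ρ⊤≡2 , a , (λ _ → ⊤) ,
    (λ _ → proj₁ (⊤-large n≡) , ρ⊤≡2 , trans (proj₂ (proj₂ (⊤-large n≡))) (cong (_+ 1) (*-identityˡ t)) , ∈⊤) ,
    ∪-identityʳ ⊤ , ρ-one-line
    where
    a : Fin n
    a = subst Fin (sym (trans n≡ (+-comm (1 * t) 1))) fzero
    ρ-one-line : ∀ (K : Subset 1) → 1 ≤ ∣ K ∣ → rk M (bigUnion (λ _ → ⊤) K) ≡ ∣ K ∣ + 1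
    ρ-one-line (true ∷ [])  _ = trans (cong (rk M) (∪-identityʳ ⊤)) ρ⊤≡2
    ρ-one-line (false ∷ []) ()

module RankAtLeastThree {n : ℕ} (M : Matroid n) (r′ t : ℕ) (2≤t : 2 ≤ t)
  (ρ⊤≡r : rk M ⊤ ≡ suc (suc (suc r′))) (bound : FlatSizeBound M (suc (suc (suc r′))) t)
  (n≡ : n ≡ suc (suc r′) * t + 1) where

  open SpikeCharacterisation M r′ t 2≤t ρ⊤≡r bound n≡
  open LargeFlagCount M r t (s≤s (s≤s z≤n)) 2≤t ρ⊤≡r bound

  largeHyperplanes≡ : largeHyperplanes M r t ≡ #largeIn ⊤ q
  largeHyperplanes≡ = largeHyperplanes≡#largeIn⊤ (suc r′) refl

  largeFlags≤ : largeFlags M r t ≤ (r ∸ 1) ! * (t + 1)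
  largeFlags≤ = ≤-trans (largeFlags≤flagBound n≡) (≤-reflexive (flagBound≡ (suc r′)))

  largeHyperplanes≤ : largeHyperplanes M r t ≤ r ∸ 1
  largeHyperplanes≤ = subst (_≤ q) (sym largeHyperplanes≡) (#largeIn≤ r′ ⊤ ∣⊤∣≡)

  largeFlags-max⇔largeHyperplanes-max : largeFlags M r t ≡ (r ∸ 1) ! * (t + 1) ⇔ largeHyperplanes M r t ≡ r ∸ 1
  largeFlags-max⇔largeHyperplanes-max = mk⇔
    (λ e → trans largeHyperplanes≡ (#flagsTo≡flagBound⇒#largeIn≡ r′ ⊤ (⊤-large n≡)
             (trans (sym (largeFlags≡#flagsTo⊤ n≡)) (trans e (sym (flagBound≡ (suc r′)))))))
    (λ e → trans (largeFlags≡#flagsTo⊤ n≡) (trans (#largeIn≡⇒#flagsTo≡flagBound r′ ⊤ (⊤-large n≡)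
             (trans (sym largeHyperplanes≡) e)) (flagBound≡ (suc r′))))

  largeHyperplanes-max⇔spike : largeHyperplanes M r t ≡ r ∸ 1 ⇔ IsSpike M r t
  largeHyperplanes-max⇔spike = mk⇔
    (λ e → #largeIn≡⇒spike (trans (sym largeHyperplanes≡) e))
    (λ s → trans largeHyperplanes≡ (spike⇒#largeIn≡ s))

theorem7p2 : (r t n : ℕ) → 2 ≤ r → 2 ≤ t → n ≡ (r ∸ 1) * t + 1 →
    (M : Matroid n) → rank M ≡ r →
    (∀ (i : ℕ) (X : Subset n) → 1 ≤ i → i ≤ r → IsFlat M X → rk M X ≡ i →
      ∣ X ∣ ≤ (i ∸ 1) * t + 1) →
    (largeFlags M r t ≤ (r ∸ 1) ! * (t + 1))
    × (largeFlags M r t ≡ (r ∸ 1) ! * (t + 1) ⇔ IsSpike M r t)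
    × (2 < r →
        (largeHyperplanes M r t ≤ r ∸ 1)
        × (largeFlags M r t ≡ (r ∸ 1) ! * (t + 1) ⇔ largeHyperplanes M r t ≡ r ∸ 1))
theorem7p2 zero          _ _ ()          _ _ _ _ _
theorem7p2 (suc zero)    _ _ (s≤s ())    _ _ _ _ _
theorem7p2 (suc (suc zero)) t n _ 2≤t n≡ M ρ⊤≡2 bound =
  ≤-reflexive largeFlags≡ , mk⇔ (λ _ → spike) (λ _ → largeFlags≡) , λ { (s≤s (s≤s ())) }
  where open RankTwo M t 2≤t ρ⊤≡2 bound n≡
theorem7p2 (suc (suc (suc r′))) t n _ 2≤t n≡ M ρ⊤≡r bound =
  largeFlags≤ ,
  largeHyperplanes-max⇔spike ⇔-∘ largeFlags-max⇔largeHyperplanes-max ,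
  λ _ → largeHyperplanes≤ , largeFlags-max⇔largeHyperplanes-max
  where open RankAtLeastThree M r′ t 2≤t ρ⊤≡r bound n≡
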